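{- Let $n,k$ be integers with $n-2\geq k\geq 0$. Let $S_k(2,1;n)$ be the number of standard Young tableaux whose shape is a partition of $n$ of the form $(\lambda_1,\lambda_2,1^{n-\lambda_1-\lambda_2})$ with $\lambda_1-\lambda_2=k$. Then $$S_k(2,1;n)=(-1)^{n+k}+\sum_{i=0}^{\lfloor\frac{n-k-1}{2}\rfloor}\sum_{j=0}^{n-k-1-2i}\chi(j\equiv n+k-1 \pmod 2)\,\frac{2k+2}{n+k+1-2i-j}\binom{n-2i-2}{j}\binom{n-2i-j-1}{(n+k-j-1)/2-i},$$ where $\chi(\cdot)$ equals $1$ if the condition holds and $0$ otherwise.
   Context: A partition $(\lambda_1,\lambda_2,1^{m})$ denotes the partition with parts $\lambda_1\geq\lambda_2\geq 1\geq\cdots$, with $m$ trailing parts equal to $1$ (here $\lambda_2$ may be $0$, in which case $m=0$). These are exactly the partitions lying in the $(2,1)$-hook, i.e. partitions with $\lambda_3\leq 1$. -}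

module Defs where

open import Data.Nat using (ℕ; zero; suc; _+_; _*_; _∸_; _≤_; _<_; _≥_; _≟_; _/_; _%_)
open import Data.Nat.Combinatorics using (_C_)
open import Data.Integer using (+_)
open import Data.Rational using (ℚ; 0ℚ; 1ℚ; -_) renaming (_+_ to _+ℚ_; _*_ to _*ℚ_; _/_ to _/ℚ_)
open import Data.List using (List; []; _∷_; map; length; concat; upTo; drop; zip; filter; foldr)
open import Data.Nat.ListAction using (sum)
open import Data.List.Relation.Unary.All using (All)
open import Data.List.Relation.Unary.Linked using (Linked)
open import Data.Product using (Σ; _×_; uncurry)
open import Data.Unit using (⊤)
open import Relation.Binary.PropositionalEquality using (_≡_)
open import Relation.Nullary using (does)
open import Data.Bool using (if_then_else_)

-- i-th part of a partition (0-indexed), 0 beyond its length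
part : List ℕ → ℕ → ℕ
part []       _       = 0
part (a ∷ _)  zero    = a
part (_ ∷ as) (suc i) = part as i

IsPartition : List ℕ → Set
IsPartition ℓ = All (λ a → 1 ≤ a) ℓ × Linked _≥_ ℓ

shape : List (List ℕ) → List ℕ
shape T = map length T

occ : ℕ → List ℕ → ℕ
occ v xs = length (filter (_≟ v) xs)

-- columns strictly increase: each entry of row r+1 exceeds the entry of
-- row r directly above it (zip covers all of row r+1 since rows are weakly
-- decreasing in length)
ColsIncreasing : List (List ℕ) → Set
ColsIncreasing []             = ⊤
ColsIncreasing (r ∷ [])       = ⊤
ColsIncreasing (r ∷ r' ∷ rs)  = All (uncurry _<_) (zip r r') × ColsIncreasing (r' ∷ rs)

IsSYT : ℕ → List (List ℕ) → Set
IsSYT n T =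
  IsPartition (shape T) ×
  sum (shape T) ≡ n ×
  All (λ x → 1 ≤ x × x ≤ n) (concat T) ×
  All (λ v → occ v (concat T) ≡ 1) (map suc (upTo n)) ×
  All (Linked _<_) T ×
  ColsIncreasing T

InHook21 : ℕ → List ℕ → Set
InHook21 k ℓ = All (_≤ 1) (drop 2 ℓ) × part ℓ 0 ≡ part ℓ 1 + k

SYT21 : ℕ → ℕ → Set
SYT21 n k = Σ (List (List ℕ)) (λ T → IsSYT n T × InHook21 k (shape T))

sumTo : ℕ → (ℕ → ℚ) → ℚ
sumTo m f = foldr _+ℚ_ 0ℚ (map f (upTo (suc m)))

negOnePow : ℕ → ℚ
negOnePow zero    = 1ℚ
negOnePow (suc m) = - negOnePow m

chi : ℕ → ℕ → ℕ → ℚ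
chi n k j = if does (j % 2 ≟ (n + k ∸ 1) % 2) then 1ℚ else 0ℚ

-- the summand (2k+2)/(n+k+1-2i-j) * C(n-2i-2, j) * C(n-2i-j-1, (n+k-j-1)/2 - i);
-- the denominator n+k+1-2i-j is written as suc (n+k-2i-j), which is exact
-- in the summation range (there n+k ≥ 2i+j).
summand : ℕ → ℕ → ℕ → ℕ → ℚ
summand n k i j =
  chi n k j *ℚ
  ((+ ((2 * k + 2) * ((n ∸ 2 * i ∸ 2) C j) * ((n ∸ 2 * i ∸ j ∸ 1) C ((n + k ∸ j ∸ 1) / 2 ∸ i))))
     /ℚ suc (n + k ∸ 2 * i ∸ j))

rhs : ℕ → ℕ → ℚ
rhs n k =
  negOnePow (n + k) +ℚ
  sumTo ((n ∸ k ∸ 1) / 2) (λ i → sumTo (n ∸ k ∸ 1 ∸ 2 * i) (λ j → summand n k i j))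

-- For n ≥ k + 2 every tableau counted by S_k(2,1;n) has a nonempty second row. Let T(n,h) count
-- such hook tableaux with λ₁ − λ₂ = h, and F(n,h) = [n = h] the one-row ones. Removing the largest
-- entry, which ends row 1, row 2 or the first column, gives recurrences under which
-- T(n+1,h) + T(n,h) + F(n,h) = M(n,h), the number of Motzkin paths of length n ending at height h.
-- Hence T(k+m+1,k) is an alternating sum of the M(k+j,k), which pairs up into differences
-- M(N+1,k) − M(N,k) = Σ_j C(N,j) D(N+1−j,k), where D counts the paths without level steps.
-- The ballot formula (k+e+1) D(k+2e,k) = (k+1) C(k+2e,k+e) turns these into the summands of the
-- formula, and D vanishes exactly where χ does.

module Submission where

open import Axiom.UniquenessOfIdentityProofs using (module Decidable⇒UIP)
open import Data.Bool using (Bool; true; false; if_then_else_)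
import Data.Bool.Properties as Bool
open import Data.Empty using (⊥; ⊥-elim)
open import Data.Fin as Fin using (Fin)
open import Data.Fin.Properties using (+↔⊎)
open import Data.Integer as ℤ using (+_)
import Data.Integer.Properties as ℤ
open import Data.List using (List; []; _∷_; [_]; _++_; _∷ʳ_; length; map; concat; zip; drop; take; reverse; reverseAcc; null; upTo; applyUpTo; foldr)
import Data.List.Properties as List
open import Data.List.Relation.Binary.Permutation.Propositional using (_↭_; ↭-sym; ↭-refl)
open import Data.List.Relation.Binary.Permutation.Propositional.Properties
  using (shift; ↭-length; All-resp-↭; filter-↭; ↭-reverse; ++⁺)
open import Data.List.Relation.Unary.All as All using (All; []; _∷_)
import Data.List.Relation.Unary.All.Properties as All
open import Data.List.Relation.Unary.Linked as Linked using (Linked; []; [-]; _∷_)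
open import Data.List.Relation.Unary.Linked.Properties using (Linked⇒All)
open import Data.Nat as ℕ hiding (_/_)
open import Data.Nat.Combinatorics using (_C_; nCn≡1; nC1≡n; k>n⇒nCk≡0; nCk≡nC[n∸k]; nCk+nC[k+1]≡[n+1]C[k+1])
open import Data.Nat.DivMod using ([m+kn]%n≡m%n; [m+n]%n≡m%n; m*n/n≡m; m/n≡1+[m∸n]/n)
open import Data.Nat.ListAction using (sum)
open import Data.Nat.Properties
open import Data.Nat.Tactic.RingSolver using (solve-∀)
open import Data.Product using (Σ; ∃-syntax; _×_; _,_; proj₁; proj₂; uncurry; swap)
open import Data.Rational as ℚ using (ℚ; 0ℚ; 1ℚ; -_; _/_; toℚᵘ)
import Data.Rational.Properties as ℚ
open import Data.Rational.Unnormalised as ℚᵘ using (mkℚᵘ; *≡*)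
import Data.Rational.Unnormalised.Properties as ℚᵘ
open import Data.Sum using (_⊎_; inj₁; inj₂)
open import Data.Sum.Function.Propositional using (_⊎-↔_)
open import Data.Unit using (⊤; tt)
open import Function using (_∘_; id; flip)
open import Function.Bundles using (_↔_; mk↔ₛ′)
open import Function.Properties.Inverse using (↔-trans; ↔-sym)
open import Relation.Binary.PropositionalEquality hiding ([_])
open import Relation.Nullary using (¬_; yes; no; Irrelevant; contradiction)
open import Relation.Nullary.Decidable using (dec-true; dec-false)
open import Algebra.Properties.CommutativeSemigroup +-commutativeSemigroup using (interchange; x∙yz≈xz∙y; xy∙z≈xz∙y; x∙yz≈y∙xz)
open import Algebra.Properties.Group ℚ.+-0-group using (⁻¹-involutive)

open import Defs

-- Sums, binomial coefficients and lattice paths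

∑≤ : ℕ → (ℕ → ℕ) → ℕ
∑≤ zero    f = f 0
∑≤ (suc m) f = f 0 + ∑≤ m (f ∘ suc)

syntax ∑≤ m (λ i → e) = ∑[ i ≤ m ] e

∑≤-cong : ∀ m {f g : ℕ → ℕ} → (∀ i → i ≤ m → f i ≡ g i) → ∑≤ m f ≡ ∑≤ m g
∑≤-cong zero    f≗g = f≗g 0 z≤n
∑≤-cong (suc m) f≗g = cong₂ _+_ (f≗g 0 z≤n) (∑≤-cong m (λ i i≤m → f≗g (suc i) (s≤s i≤m)))

∑≤-suc : ∀ m (f : ℕ → ℕ) → ∑≤ (suc m) f ≡ ∑≤ m f + f (suc m)
∑≤-suc zero    f = refl
∑≤-suc (suc m) f = trans (cong (_+_ (f 0)) (∑≤-suc m (f ∘ suc))) (sym (+-assoc (f 0) _ _))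

∑≤-distrib-+ : ∀ m (f g : ℕ → ℕ) → ∑[ i ≤ m ] (f i + g i) ≡ ∑≤ m f + ∑≤ m g
∑≤-distrib-+ zero    f g = refl
∑≤-distrib-+ (suc m) f g = begin
  f 0 + g 0 + ∑[ i ≤ m ] (f (suc i) + g (suc i))   ≡⟨ cong (_+_ (f 0 + g 0)) (∑≤-distrib-+ m (f ∘ suc) (g ∘ suc)) ⟩
  f 0 + g 0 + (∑≤ m (f ∘ suc) + ∑≤ m (g ∘ suc))    ≡⟨ interchange (f 0) (g 0) _ _ ⟩
  f 0 + ∑≤ m (f ∘ suc) + (g 0 + ∑≤ m (g ∘ suc))    ∎
  where open ≡-Reasoning

∑≤-vanishing-tail : ∀ m d (f : ℕ → ℕ) → (∀ i → m < i → f i ≡ 0) → ∑≤ (m + d) f ≡ ∑≤ m f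
∑≤-vanishing-tail m zero    f tail0 = cong (λ l → ∑≤ l f) (+-identityʳ m)
∑≤-vanishing-tail m (suc d) f tail0 = begin
  ∑≤ (m + suc d) f              ≡⟨ cong (λ l → ∑≤ l f) (+-suc m d) ⟩
  ∑≤ (suc (m + d)) f            ≡⟨ ∑≤-suc (m + d) f ⟩
  ∑≤ (m + d) f + f (suc (m + d)) ≡⟨ cong₂ _+_ (∑≤-vanishing-tail m d f tail0) (tail0 _ (s≤s (m≤m+n m d))) ⟩
  ∑≤ m f + 0                    ≡⟨ +-identityʳ _ ⟩
  ∑≤ m f                        ∎
  where open ≡-Reasoning

C-absorb : ∀ n k → suc k * (suc n C suc k) ≡ suc n * (n C k)
C-absorb zero    zero    = refl
C-absorb zero    (suc k) = *-zeroʳ (suc (suc k))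
C-absorb (suc n) zero    = begin
  1 * (suc (suc n) C 1) ≡⟨ *-identityˡ _ ⟩
  suc (suc n) C 1       ≡⟨ nC1≡n (suc (suc n)) ⟩
  suc (suc n)           ≡⟨ sym (*-identityʳ _) ⟩
  suc (suc n) * 1       ∎
  where open ≡-Reasoning
C-absorb (suc n) (suc k) = begin
  suc (suc k) * (suc (suc n) C suc (suc k))
    ≡⟨ cong (suc (suc k) *_) (sym (nCk+nC[k+1]≡[n+1]C[k+1] (suc n) (suc k))) ⟩
  suc (suc k) * (suc n C suc k + suc n C suc (suc k))
    ≡⟨ split (suc k) (suc n C suc k) (suc n C suc (suc k)) ⟩
  suc k * (suc n C suc k) + suc n C suc k + suc (suc k) * (suc n C suc (suc k))
    ≡⟨ cong₂ (λ x y → x + suc n C suc k + y) (C-absorb n k) (C-absorb n (suc k)) ⟩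
  suc n * (n C k) + suc n C suc k + suc n * (n C suc k)
    ≡⟨ cong (λ x → suc n * (n C k) + x + suc n * (n C suc k)) (sym (nCk+nC[k+1]≡[n+1]C[k+1] n k)) ⟩
  suc n * (n C k) + (n C k + n C suc k) + suc n * (n C suc k)
    ≡⟨ join n (n C k) (n C suc k) ⟩
  suc (suc n) * (n C k + n C suc k)
    ≡⟨ cong (suc (suc n) *_) (nCk+nC[k+1]≡[n+1]C[k+1] n k) ⟩
  suc (suc n) * (suc n C suc k) ∎
  where open ≡-Reasoning
        split : ∀ a x y → suc a * (x + y) ≡ a * x + x + suc a * y
        split = solve-∀
        join : ∀ n x y → suc n * x + (x + y) + suc n * y ≡ suc (suc n) * (x + y)
        join = solve-∀

C-sym : ∀ r s {n} → n ≡ r + s → n C r ≡ n C s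
C-sym r s refl = trans (nCk≡nC[n∸k] (m≤m+n r s)) (cong ((r + s) C_) (m+n∸m≡n r s))

C-ratio : ∀ r s {M} → M ≡ r + s → suc r * (M C suc r) ≡ s * (M C r)
C-ratio r zero    refl = begin
  suc r * ((r + 0) C suc r) ≡⟨ cong (λ x → suc r * (x C suc r)) (+-identityʳ r) ⟩
  suc r * (r C suc r)       ≡⟨ cong (suc r *_) (k>n⇒nCk≡0 (n<1+n r)) ⟩
  suc r * 0                 ≡⟨ *-zeroʳ (suc r) ⟩
  0                         ∎
  where open ≡-Reasoning
C-ratio r (suc s) refl = begin
  suc r * ((r + suc s) C suc r)     ≡⟨ cong (λ x → suc r * (x C suc r)) (+-suc r s) ⟩
  suc r * (suc (r + s) C suc r)     ≡⟨ C-absorb (r + s) r ⟩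
  suc (r + s) * ((r + s) C r)       ≡⟨ cong₂ _*_ (cong suc (+-comm r s)) (C-sym r s refl) ⟩
  suc (s + r) * ((r + s) C s)       ≡⟨ cong (λ x → suc (s + r) * (x C s)) (+-comm r s) ⟩
  suc (s + r) * ((s + r) C s)       ≡⟨ C-absorb (s + r) s ⟨
  suc s * (suc (s + r) C suc s)     ≡⟨ cong (λ x → suc s * (x C suc s)) (trans (cong suc (+-comm s r)) (sym (+-suc r s))) ⟩
  suc s * ((r + suc s) C suc s)     ≡⟨ cong (suc s *_) (C-sym r (suc s) refl) ⟨
  suc s * ((r + suc s) C r)         ∎
  where open ≡-Reasoning

-- Paths of n steps from height 0 to height h that never go below 0, with steps −1, 0, +1
-- (motzkin) or −1, +1 (dyck).
motzkin : ℕ → ℕ → ℕ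
motzkin zero    zero    = 1
motzkin zero    (suc h) = 0
motzkin (suc n) zero    = motzkin n 0 + motzkin n 1
motzkin (suc n) (suc h) = motzkin n h + motzkin n (suc h) + motzkin n (suc (suc h))

dyck : ℕ → ℕ → ℕ
dyck zero    zero    = 1
dyck zero    (suc h) = 0
dyck (suc n) zero    = dyck n 1
dyck (suc n) (suc h) = dyck n h + dyck n (suc (suc h))

motzkin-< : ∀ {n h} → n < h → motzkin n h ≡ 0
motzkin-< {zero}  {suc h} _         = refl
motzkin-< {suc n} {suc h} (s≤s n<h) =
  cong₂ _+_ (cong₂ _+_ (motzkin-< n<h) (motzkin-< (m≤n⇒m≤1+n n<h))) (motzkin-< (m≤n⇒m≤1+n (m≤n⇒m≤1+n n<h)))

motzkin-diag : ∀ n → motzkin n n ≡ 1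
motzkin-diag zero    = refl
motzkin-diag (suc n) = cong₂ _+_ (cong₂ _+_ (motzkin-diag n) (motzkin-< (n<1+n n))) (motzkin-< (m≤n⇒m≤1+n (n<1+n n)))

dyck-< : ∀ {n h} → n < h → dyck n h ≡ 0
dyck-< {zero}  {suc h} _         = refl
dyck-< {suc n} {suc h} (s≤s n<h) = cong₂ _+_ (dyck-< n<h) (dyck-< (m≤n⇒m≤1+n (m≤n⇒m≤1+n n<h)))

dyck-diag : ∀ n → dyck n n ≡ 1
dyck-diag zero    = refl
dyck-diag (suc n) = cong₂ _+_ (dyck-diag n) (dyck-< (m≤n⇒m≤1+n (n<1+n n)))

dyck-odd : ∀ n h d → n + h ≡ suc (d + d) → dyck n h ≡ 0
dyck-odd zero    zero    d ()
dyck-odd zero    (suc h) d _ = refl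
dyck-odd (suc n) zero    d eq = dyck-odd n 1 d (trans (+-comm n 1) (trans (cong suc (sym (+-identityʳ n))) eq))
dyck-odd (suc n) (suc h) zero    eq with () ← trans (sym (+-suc n h)) (suc-injective eq)
dyck-odd (suc n) (suc h) (suc d) eq =
  cong₂ _+_ (dyck-odd n h d n+h≡1+2d) (dyck-odd n (suc (suc h)) (suc d) n+2+h≡3+2d)
  where n+h≡1+2d : n + h ≡ suc (d + d)
        n+h≡1+2d = suc-injective (trans (sym (+-suc n h)) (trans (suc-injective eq) (cong suc (+-suc d d))))
        n+2+h≡3+2d : n + suc (suc h) ≡ suc (suc d + suc d)
        n+2+h≡3+2d = begin
          n + suc (suc h)       ≡⟨ +-suc n (suc h) ⟩
          suc (n + suc h)       ≡⟨ cong suc (+-suc n h) ⟩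
          suc (suc (n + h))     ≡⟨ cong (suc ∘ suc) n+h≡1+2d ⟩
          suc (suc (suc (d + d))) ≡⟨ cong (suc ∘ suc) (+-suc d d) ⟨
          suc (suc (d + suc d)) ∎
          where open ≡-Reasoning

private
  -- A and B are the two terms of the recursion for dyck, B₁ and B₂ consecutive binomial coefficients.
  ballot-step : ∀ k e {A B B₁ B₂} →
    (k + e + 2) * A ≡ (k + 1) * B₁ → (k + e + 3) * B ≡ (k + 3) * B₂ → (k + e + 2) * B₂ ≡ (e + 1) * B₁ →
    (k + e + 3) * (A + B) ≡ (k + 2) * (B₁ + B₂)
  ballot-step k e {A} {B} {B₁} {B₂} eqA eqB ratio = *-cancelˡ-≡ _ _ (k + e + 2) {{k+e+2≢0}} (begin
    (k + e + 2) * ((k + e + 3) * (A + B))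
      ≡⟨ expand k e A B ⟩
    (k + e + 3) * ((k + e + 2) * A) + (k + e + 2) * ((k + e + 3) * B)
      ≡⟨ cong₂ (λ x y → (k + e + 3) * x + (k + e + 2) * y) eqA eqB ⟩
    (k + e + 3) * ((k + 1) * B₁) + (k + e + 2) * ((k + 3) * B₂)
      ≡⟨ cong (_+_ ((k + e + 3) * ((k + 1) * B₁))) (trans (commute k e B₂) (cong ((k + 3) *_) ratio)) ⟩
    (k + e + 3) * ((k + 1) * B₁) + (k + 3) * ((e + 1) * B₁)
      ≡⟨ regroup k e B₁ ⟩
    (k + e + 2) * ((k + 2) * B₁) + (k + 2) * ((e + 1) * B₁)
      ≡⟨ cong (λ x → (k + e + 2) * ((k + 2) * B₁) + (k + 2) * x) ratio ⟨
    (k + e + 2) * ((k + 2) * B₁) + (k + 2) * ((k + e + 2) * B₂)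
      ≡⟨ collect k e B₁ B₂ ⟩
    (k + e + 2) * ((k + 2) * (B₁ + B₂)) ∎)
    where
    open ≡-Reasoning
    k+e+2≢0 : NonZero (k + e + 2)
    k+e+2≢0 = subst NonZero (+-comm 2 (k + e)) _
    expand : ∀ k e A B → (k + e + 2) * ((k + e + 3) * (A + B)) ≡ (k + e + 3) * ((k + e + 2) * A) + (k + e + 2) * ((k + e + 3) * B)
    expand = solve-∀
    commute : ∀ k e B₂ → (k + e + 2) * ((k + 3) * B₂) ≡ (k + 3) * ((k + e + 2) * B₂)
    commute = solve-∀
    regroup : ∀ k e B₁ → (k + e + 3) * ((k + 1) * B₁) + (k + 3) * ((e + 1) * B₁) ≡
                         (k + e + 2) * ((k + 2) * B₁) + (k + 2) * ((e + 1) * B₁)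
    regroup = solve-∀
    collect : ∀ k e B₁ B₂ → (k + e + 2) * ((k + 2) * B₁) + (k + 2) * ((k + e + 2) * B₂) ≡ (k + e + 2) * ((k + 2) * (B₁ + B₂))
    collect = solve-∀

ballot : ∀ e k {n} → n ≡ k + (e + e) → (k + e + 1) * dyck n k ≡ (k + 1) * (n C (k + e))
ballot zero    k       refl = begin
  (k + 0 + 1) * dyck (k + 0) k       ≡⟨ cong (λ x → (x + 1) * dyck x k) (+-identityʳ k) ⟩
  (k + 1) * dyck k k                 ≡⟨ cong ((k + 1) *_) (trans (dyck-diag k) (sym (nCn≡1 k))) ⟩
  (k + 1) * (k C k)                  ≡⟨ cong (λ x → (k + 1) * (x C x)) (+-identityʳ k) ⟨
  (k + 1) * ((k + 0) C (k + 0))      ∎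
  where open ≡-Reasoning
ballot (suc e) zero    {suc n} n+1≡2e+2 = begin
  (suc e + 1) * dyck n 1             ≡⟨ ballot e 1 (trans n≡e+1+e (+-suc e e)) ⟩
  2 * (n C suc e)                    ≡⟨ double (n C suc e) ⟩
  1 * (n C suc e + n C suc e)        ≡⟨ cong (λ x → 1 * (x + n C suc e)) (C-sym e (suc e) n≡e+1+e) ⟨
  1 * (n C e + n C suc e)            ≡⟨ cong (1 *_) (nCk+nC[k+1]≡[n+1]C[k+1] n e) ⟩
  1 * (suc n C suc e)                ∎
  where open ≡-Reasoning
        n≡e+1+e : n ≡ e + suc e
        n≡e+1+e = suc-injective n+1≡2e+2
        double : ∀ x → 2 * x ≡ 1 * (x + x)
        double = solve-∀
ballot (suc e) (suc k) {suc n} n+1≡k+2e+3 = begin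
  (suc k + suc e + 1) * (dyck n k + dyck n (suc (suc k)))
    ≡⟨ cong (_* (dyck n k + dyck n (suc (suc k)))) (coeff₁ k e) ⟩
  (k + e + 3) * (dyck n k + dyck n (suc (suc k)))
    ≡⟨ ballot-step k e IH₁ IH₂ ratio ⟩
  (k + 2) * (n C (k + suc e) + n C suc (k + suc e))
    ≡⟨ cong₂ _*_ (+-suc k 1) (nCk+nC[k+1]≡[n+1]C[k+1] n (k + suc e)) ⟩
  (suc k + 1) * (suc n C (suc k + suc e)) ∎
  where
  open ≡-Reasoning
  n≡ : n ≡ k + (suc e + suc e)
  n≡ = suc-injective n+1≡k+2e+3
  coeff₁ : ∀ k e → suc k + suc e + 1 ≡ k + e + 3
  coeff₁ = solve-∀
  IH₁ : (k + e + 2) * dyck n k ≡ (k + 1) * (n C (k + suc e))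
  IH₁ = trans (cong (_* dyck n k) (coeff₂ k e)) (ballot (suc e) k n≡)
    where coeff₂ : ∀ k e → k + e + 2 ≡ k + suc e + 1
          coeff₂ = solve-∀
  IH₂ : (k + e + 3) * dyck n (suc (suc k)) ≡ (k + 3) * (n C suc (k + suc e))
  IH₂ = begin
    (k + e + 3) * dyck n (suc (suc k))            ≡⟨ cong (_* dyck n (suc (suc k))) (coeff₃ k e) ⟩
    (suc (suc k) + e + 1) * dyck n (suc (suc k))  ≡⟨ ballot e (suc (suc k)) (trans n≡ (index₁ k e)) ⟩
    (suc (suc k) + 1) * (n C (suc (suc k) + e))   ≡⟨ cong₂ (λ x y → x * (n C y)) (+-comm (suc (suc k)) 1) (index₂ k e) ⟩
    (1 + suc (suc k)) * (n C suc (k + suc e))     ≡⟨ cong (_* (n C suc (k + suc e))) (+-comm 3 k) ⟩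
    (k + 3) * (n C suc (k + suc e))               ∎
    where coeff₃ : ∀ k e → k + e + 3 ≡ suc (suc k) + e + 1
          coeff₃ = solve-∀
          index₁ : ∀ k e → k + (suc e + suc e) ≡ suc (suc k) + (e + e)
          index₁ = solve-∀
          index₂ : ∀ k e → suc (suc k) + e ≡ suc (k + suc e)
          index₂ = solve-∀
  ratio : (k + e + 2) * (n C suc (k + suc e)) ≡ (e + 1) * (n C (k + suc e))
  ratio = subst₂ (λ x y → x * (n C suc (k + suc e)) ≡ y * (n C (k + suc e)))
                 (coeff₄ k e) (+-comm 1 e) (C-ratio (k + suc e) (suc e) (trans n≡ (index₃ k e)))
    where coeff₄ : ∀ k e → suc (k + suc e) ≡ k + e + 2
          coeff₄ = solve-∀
          index₃ : ∀ k e → k + (suc e + suc e) ≡ k + suc e + suc e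
          index₃ = solve-∀

∑-C-dyck-suc : ∀ N k →
  ∑[ j ≤ suc N ] ((suc N C j) * dyck (suc N ∸ j) k) ≡
  ∑[ j ≤ N ] ((N C j) * dyck (suc N ∸ j) k) + ∑[ j ≤ N ] ((N C j) * dyck (N ∸ j) k)
∑-C-dyck-suc N k = begin
  1 * dyck (suc N) k + ∑[ j ≤ N ] ((suc N C suc j) * dyck (N ∸ j) k)
    ≡⟨ cong (_+_ (1 * dyck (suc N) k)) (trans (∑≤-cong N pascal) (∑≤-distrib-+ N _ _)) ⟩
  1 * dyck (suc N) k + (∑≤ N unshifted + ∑[ j ≤ N ] ((N C suc j) * dyck (N ∸ j) k))
    ≡⟨ x∙yz≈xz∙y (1 * dyck (suc N) k) _ _ ⟩
  ∑≤ (suc N) shifted + ∑≤ N unshifted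
    ≡⟨ cong (_+ ∑≤ N unshifted) (∑≤-suc N shifted) ⟩
  ∑≤ N shifted + (N C suc N) * dyck (N ∸ N) k + ∑≤ N unshifted
    ≡⟨ cong (λ x → ∑≤ N shifted + x * dyck (N ∸ N) k + ∑≤ N unshifted) (k>n⇒nCk≡0 (n<1+n N)) ⟩
  ∑≤ N shifted + 0 + ∑≤ N unshifted
    ≡⟨ cong (_+ ∑≤ N unshifted) (+-identityʳ _) ⟩
  ∑≤ N shifted + ∑≤ N unshifted ∎
  where
  open ≡-Reasoning
  shifted unshifted : ℕ → ℕ
  shifted j = (N C j) * dyck (suc N ∸ j) k
  unshifted j = (N C j) * dyck (N ∸ j) k
  pascal : ∀ j → j ≤ N → (suc N C suc j) * dyck (N ∸ j) k ≡ unshifted j + (N C suc j) * dyck (N ∸ j) k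
  pascal j _ = trans (cong (_* dyck (N ∸ j) k) (sym (nCk+nC[k+1]≡[n+1]C[k+1] N j))) (*-distribʳ-+ (dyck (N ∸ j) k) (N C j) _)

-- Choosing the j positions of the level steps leaves a path with steps ±1 only.
motzkin≡∑-C-dyck : ∀ N k → motzkin N k ≡ ∑[ j ≤ N ] ((N C j) * dyck (N ∸ j) k)
motzkin≡∑-C-dyck zero    zero    = refl
motzkin≡∑-C-dyck zero    (suc k) = refl
motzkin≡∑-C-dyck (suc N) zero    = begin
  motzkin N 0 + motzkin N 1
    ≡⟨ +-comm (motzkin N 0) _ ⟩
  motzkin N 1 + motzkin N 0
    ≡⟨ cong₂ _+_ (motzkin≡∑-C-dyck N 1) (motzkin≡∑-C-dyck N 0) ⟩
  ∑[ j ≤ N ] ((N C j) * dyck (N ∸ j) 1) + ∑[ j ≤ N ] ((N C j) * dyck (N ∸ j) 0)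
    ≡⟨ cong (_+ ∑[ j ≤ N ] ((N C j) * dyck (N ∸ j) 0))
            (∑≤-cong N (λ j j≤N → cong (λ x → (N C j) * dyck x 0) (sym (+-∸-assoc 1 j≤N)))) ⟩
  ∑[ j ≤ N ] ((N C j) * dyck (suc N ∸ j) 0) + ∑[ j ≤ N ] ((N C j) * dyck (N ∸ j) 0)
    ≡⟨ ∑-C-dyck-suc N 0 ⟨
  ∑[ j ≤ suc N ] ((suc N C j) * dyck (suc N ∸ j) 0) ∎
  where open ≡-Reasoning
motzkin≡∑-C-dyck (suc N) (suc k) = begin
  motzkin N k + motzkin N (suc k) + motzkin N (suc (suc k))
    ≡⟨ xy∙z≈xz∙y (motzkin N k) _ _ ⟩
  motzkin N k + motzkin N (suc (suc k)) + motzkin N (suc k)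
    ≡⟨ cong₂ _+_ (cong₂ _+_ (motzkin≡∑-C-dyck N k) (motzkin≡∑-C-dyck N (suc (suc k)))) (motzkin≡∑-C-dyck N (suc k)) ⟩
  ∑≤ N (term k) + ∑≤ N (term (suc (suc k))) + ∑≤ N (term (suc k))
    ≡⟨ cong (_+ ∑≤ N (term (suc k))) (sym (∑≤-distrib-+ N _ _)) ⟩
  ∑[ j ≤ N ] (term k j + term (suc (suc k)) j) + ∑≤ N (term (suc k))
    ≡⟨ cong (_+ ∑≤ N (term (suc k))) (∑≤-cong N step) ⟩
  ∑[ j ≤ N ] ((N C j) * dyck (suc N ∸ j) (suc k)) + ∑≤ N (term (suc k))
    ≡⟨ ∑-C-dyck-suc N (suc k) ⟨
  ∑[ j ≤ suc N ] ((suc N C j) * dyck (suc N ∸ j) (suc k)) ∎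
  where
  open ≡-Reasoning
  term : ℕ → ℕ → ℕ
  term h j = (N C j) * dyck (N ∸ j) h
  step : ∀ j → j ≤ N → term k j + term (suc (suc k)) j ≡ (N C j) * dyck (suc N ∸ j) (suc k)
  step j j≤N = trans (sym (*-distribˡ-+ (N C j) _ _)) (cong (λ x → (N C j) * dyck x (suc k)) (sym (+-∸-assoc 1 j≤N)))

Δmotzkin : ℕ → ℕ → ℕ
Δmotzkin k m = ∑[ j ≤ m ] (((k + m ∸ 1) C j) * dyck (k + m ∸ j) k)

Δmotzkin-+-motzkin : ∀ k m {M} → k + m ≡ suc M → Δmotzkin k m + motzkin M k ≡ motzkin (suc M) k
Δmotzkin-+-motzkin k m {M} k+m≡1+M = begin
  Δmotzkin k m + motzkin M k
    ≡⟨ cong₂ _+_ Δmotzkin≡ (motzkin≡∑-C-dyck M k) ⟩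
  ∑≤ M shifted + ∑[ j ≤ M ] ((M C j) * dyck (M ∸ j) k)
    ≡⟨ ∑-C-dyck-suc M k ⟨
  ∑[ j ≤ suc M ] ((suc M C j) * dyck (suc M ∸ j) k)
    ≡⟨ motzkin≡∑-C-dyck (suc M) k ⟨
  motzkin (suc M) k ∎
  where
  open ≡-Reasoning
  shifted : ℕ → ℕ
  shifted j = (M C j) * dyck (suc M ∸ j) k
  shifted-vanishes : ∀ j → m < j → shifted j ≡ 0
  shifted-vanishes j m<j with j ≤? M
  ... | no  j≰M = cong (_* dyck (suc M ∸ j) k) (k>n⇒nCk≡0 (≰⇒> j≰M))
  ... | yes j≤M = trans (cong ((M C j) *_) (dyck-< 1+M∸j<k)) (*-zeroʳ (M C j))
    where 1+M∸j<k : suc M ∸ j < k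
          1+M∸j<k = subst (suc M ∸ j <_) (m+n∸n≡m k j)
                      (∸-monoˡ-< (subst (_< k + j) k+m≡1+M (+-monoʳ-< k m<j)) (m≤n⇒m≤1+n j≤M))
  Δmotzkin≡ : Δmotzkin k m ≡ ∑≤ M shifted
  Δmotzkin≡ = begin
    Δmotzkin k m
      ≡⟨ ∑≤-cong m (λ j _ → cong (λ x → ((x ∸ 1) C j) * dyck (x ∸ j) k) k+m≡1+M) ⟩
    ∑≤ m shifted
      ≡⟨ ∑≤-vanishing-tail m k shifted shifted-vanishes ⟨
    ∑≤ (m + k) shifted
      ≡⟨ cong (λ x → ∑≤ x shifted) (trans (+-comm m k) k+m≡1+M) ⟩
    ∑≤ (suc M) shifted
      ≡⟨ ∑≤-suc M shifted ⟩
    ∑≤ M shifted + (M C suc M) * dyck (M ∸ M) k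
      ≡⟨ cong (λ x → ∑≤ M shifted + x * dyck (M ∸ M) k) (k>n⇒nCk≡0 (n<1+n M)) ⟩
    ∑≤ M shifted + 0
      ≡⟨ +-identityʳ _ ⟩
    ∑≤ M shifted ∎

-- The number of hook tableaux

-- rowCount n h and hookCount n h count the one-row tableaux and the tableaux with nonempty second
-- row that have n cells and λ₁ − λ₂ = h (Hook↔Fin); the recursion removes the largest entry from
-- the end of row 1, of row 2 or of the first column.
rowCount : ℕ → ℕ → ℕ
rowCount zero    zero    = 1
rowCount zero    (suc h) = 0
rowCount (suc n) zero    = 0
rowCount (suc n) (suc h) = rowCount n h

hookCount : ℕ → ℕ → ℕ
hookCount zero    h       = 0
hookCount (suc n) zero    = rowCount n 1 + hookCount n 1 + hookCount n 0
hookCount (suc n) (suc h) = hookCount n h + (rowCount n (suc (suc h)) + hookCount n (suc (suc h)) + hookCount n (suc h))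

rowCount-< : ∀ {n h} → n < h → rowCount n h ≡ 0
rowCount-< {zero}  {suc h} _         = refl
rowCount-< {suc n} {suc h} (s≤s n<h) = rowCount-< n<h

rowCount-> : ∀ {n h} → h < n → rowCount n h ≡ 0
rowCount-> {suc n} {zero}  _         = refl
rowCount-> {suc n} {suc h} (s≤s h<n) = rowCount-> h<n

hookCount-≤ : ∀ {n h} → n ≤ suc h → hookCount n h ≡ 0
hookCount-≤ {zero}        {h}     _               = refl
hookCount-≤ {suc zero}    {zero}  _               = refl
hookCount-≤ {suc n}       {suc h} (s≤s n≤1+h) =
  cong₂ _+_ (hookCount-≤ n≤1+h)
    (cong₂ _+_ (cong₂ _+_ (rowCount-< (s≤s n≤1+h)) (hookCount-≤ (m≤n⇒m≤1+n (m≤n⇒m≤1+n n≤1+h))))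
               (hookCount-≤ (m≤n⇒m≤1+n n≤1+h)))

hookCount-+-motzkin : ∀ n h → hookCount (suc n) h + hookCount n h + rowCount n h ≡ motzkin n h
hookCount-+-motzkin zero    zero    = refl
hookCount-+-motzkin zero    (suc h) = refl
hookCount-+-motzkin (suc n) zero    = begin
  rowCount (suc n) 1 + hookCount (suc n) 1 + hookCount (suc n) 0 + (rowCount n 1 + hookCount n 1 + hookCount n 0) + 0
    ≡⟨ regroup (rowCount n 0) (hookCount (suc n) 1) (hookCount (suc n) 0) (rowCount n 1) (hookCount n 1) (hookCount n 0) ⟩
  (hookCount (suc n) 0 + hookCount n 0 + rowCount n 0) + (hookCount (suc n) 1 + hookCount n 1 + rowCount n 1)
    ≡⟨ cong₂ _+_ (hookCount-+-motzkin n 0) (hookCount-+-motzkin n 1) ⟩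
  motzkin n 0 + motzkin n 1 ∎
  where open ≡-Reasoning
        regroup : ∀ a b c d e f → a + b + c + (d + e + f) + 0 ≡ (c + f + a) + (b + e + d)
        regroup = solve-∀
hookCount-+-motzkin (suc n) (suc h) = begin
  hookCount (suc n) h + (rowCount (suc n) (suc (suc h)) + hookCount (suc n) (suc (suc h)) + hookCount (suc n) (suc h))
   + (hookCount n h + (rowCount n (suc (suc h)) + hookCount n (suc (suc h)) + hookCount n (suc h))) + rowCount n h
    ≡⟨ regroup (hookCount (suc n) h) (rowCount n (suc h)) (hookCount (suc n) (suc (suc h))) (hookCount (suc n) (suc h))
               (hookCount n h) (rowCount n (suc (suc h))) (hookCount n (suc (suc h))) (hookCount n (suc h)) (rowCount n h) ⟩
  (hookCount (suc n) h + hookCount n h + rowCount n h)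
   + (hookCount (suc n) (suc h) + hookCount n (suc h) + rowCount n (suc h))
   + (hookCount (suc n) (suc (suc h)) + hookCount n (suc (suc h)) + rowCount n (suc (suc h)))
    ≡⟨ cong₂ _+_ (cong₂ _+_ (hookCount-+-motzkin n h) (hookCount-+-motzkin n (suc h))) (hookCount-+-motzkin n (suc (suc h))) ⟩
  motzkin n h + motzkin n (suc h) + motzkin n (suc (suc h)) ∎
  where open ≡-Reasoning
        regroup : ∀ a b c d e f x y z → a + (b + c + d) + (e + (f + x + y)) + z ≡ (a + e + z) + (d + y + b) + (c + x + f)
        regroup = solve-∀

hookCount-consecutive : ∀ k m → hookCount (suc (k + suc m)) k + hookCount (suc (k + m)) k ≡ motzkin (k + suc m) k
hookCount-consecutive k m = begin
  hookCount (suc (k + suc m)) k + hookCount (suc (k + m)) k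
    ≡⟨ cong (_+_ (hookCount (suc (k + suc m)) k)) (cong (λ x → hookCount x k) (+-suc k m)) ⟨
  hookCount (suc (k + suc m)) k + hookCount (k + suc m) k
    ≡⟨ +-identityʳ _ ⟨
  hookCount (suc (k + suc m)) k + hookCount (k + suc m) k + 0
    ≡⟨ cong (_+_ (hookCount (suc (k + suc m)) k + hookCount (k + suc m) k)) (rowCount-> k<k+1+m) ⟨
  hookCount (suc (k + suc m)) k + hookCount (k + suc m) k + rowCount (k + suc m) k
    ≡⟨ hookCount-+-motzkin (k + suc m) k ⟩
  motzkin (k + suc m) k ∎
  where open ≡-Reasoning
        k<k+1+m : k < k + suc m
        k<k+1+m = subst (k <_) (sym (+-suc k m)) (s≤s (m≤m+n k m))

hookCount-two-step : ∀ k m → hookCount (suc (k + suc (suc m))) k ≡ Δmotzkin k (suc (suc m)) + hookCount (suc (k + m)) k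
hookCount-two-step k m = +-cancelʳ-≡ a₁ a₂ (Δmotzkin k (suc (suc m)) + a₀) (begin
  a₂ + a₁                                       ≡⟨ hookCount-consecutive k (suc m) ⟩
  motzkin (k + suc (suc m)) k                   ≡⟨ cong (λ x → motzkin x k) (+-suc k (suc m)) ⟩
  motzkin (suc (k + suc m)) k                   ≡⟨ Δmotzkin-+-motzkin k (suc (suc m)) (+-suc k (suc m)) ⟨
  Δmotzkin k (suc (suc m)) + motzkin (k + suc m) k ≡⟨ cong (_+_ (Δmotzkin k (suc (suc m)))) (hookCount-consecutive k m) ⟨
  Δmotzkin k (suc (suc m)) + (a₁ + a₀)          ≡⟨ x∙yz≈xz∙y (Δmotzkin k (suc (suc m))) a₁ a₀ ⟩
  Δmotzkin k (suc (suc m)) + a₀ + a₁            ∎)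
  where open ≡-Reasoning
        a₀ a₁ a₂ : ℕ
        a₀ = hookCount (suc (k + m)) k
        a₁ = hookCount (suc (k + suc m)) k
        a₂ = hookCount (suc (k + suc (suc m))) k

evenBit : ℕ → ℕ
evenBit zero          = 1
evenBit (suc zero)    = 0
evenBit (suc (suc m)) = evenBit m

oddBit : ℕ → ℕ
oddBit m = evenBit (suc m)

hookCount-alternating : ∀ k m →
  hookCount (suc (k + m)) k + evenBit m ≡ oddBit m + ∑[ i ≤ ⌊ m /2⌋ ] Δmotzkin k (m ∸ (i + i))
hookCount-alternating k zero = begin
  hookCount (suc (k + 0)) k + 1  ≡⟨ cong (_+ 1) (hookCount-≤ (s≤s (≤-reflexive (+-identityʳ k)))) ⟩
  1                              ≡⟨ trans (sym (dyck-diag k)) (cong (λ x → dyck x k) (sym (+-identityʳ k))) ⟩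
  dyck (k + 0) k                 ≡⟨ *-identityˡ _ ⟨
  1 * dyck (k + 0) k             ∎
  where open ≡-Reasoning
hookCount-alternating k (suc zero) = begin
  hookCount (suc (k + 1)) k + 0
    ≡⟨ cong (_+_ (hookCount (suc (k + 1)) k)) (hookCount-≤ (s≤s (≤-reflexive (+-identityʳ k)))) ⟨
  hookCount (suc (k + 1)) k + hookCount (suc (k + 0)) k ≡⟨ hookCount-consecutive k 0 ⟩
  motzkin (k + 1) k                                    ≡⟨ cong (λ x → motzkin x k) (+-comm k 1) ⟩
  motzkin (suc k) k                                    ≡⟨ Δmotzkin-+-motzkin k 1 (+-comm k 1) ⟨
  Δmotzkin k 1 + motzkin k k                           ≡⟨ cong (_+_ (Δmotzkin k 1)) (motzkin-diag k) ⟩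
  Δmotzkin k 1 + 1                                     ≡⟨ +-comm (Δmotzkin k 1) 1 ⟩
  1 + Δmotzkin k 1                                     ∎
  where open ≡-Reasoning
hookCount-alternating k (suc (suc m)) = begin
  hookCount (suc (k + suc (suc m))) k + evenBit m
    ≡⟨ cong (_+ evenBit m) (hookCount-two-step k m) ⟩
  Δmotzkin k (suc (suc m)) + hookCount (suc (k + m)) k + evenBit m
    ≡⟨ +-assoc (Δmotzkin k (suc (suc m))) _ _ ⟩
  Δmotzkin k (suc (suc m)) + (hookCount (suc (k + m)) k + evenBit m)
    ≡⟨ cong (_+_ (Δmotzkin k (suc (suc m)))) (hookCount-alternating k m) ⟩
  Δmotzkin k (suc (suc m)) + (oddBit m + ∑[ i ≤ ⌊ m /2⌋ ] Δmotzkin k (m ∸ (i + i)))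
    ≡⟨ x∙yz≈y∙xz (Δmotzkin k (suc (suc m))) (oddBit m) _ ⟩
  oddBit m + (Δmotzkin k (suc (suc m)) + ∑[ i ≤ ⌊ m /2⌋ ] Δmotzkin k (m ∸ (i + i)))
    ≡⟨ cong (λ x → oddBit m + (Δmotzkin k (suc (suc m)) + x))
            (∑≤-cong ⌊ m /2⌋ (λ i _ → cong (λ x → Δmotzkin k (suc m ∸ x)) (sym (+-suc i i)))) ⟩
  oddBit m + ∑[ i ≤ suc ⌊ m /2⌋ ] Δmotzkin k (suc (suc m) ∸ (i + i)) ∎
  where open ≡-Reasoning

-- The closed formula

fromℕ : ℕ → ℚ
fromℕ n = + n / 1

fromℕ-+ : ∀ a b → fromℕ (a + b) ≡ fromℕ a ℚ.+ fromℕ b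
fromℕ-+ a b = ℚ.toℚᵘ-injective (ℚᵘ.≃-sym (begin
  toℚᵘ (fromℕ a ℚ.+ fromℕ b)                ≈⟨ ℚ.toℚᵘ-homo-+ (fromℕ a) (fromℕ b) ⟩
  toℚᵘ (fromℕ a) ℚᵘ.+ toℚᵘ (fromℕ b)
    ≈⟨ ℚᵘ.+-cong (ℚ.toℚᵘ-fromℚᵘ (mkℚᵘ (+ a) 0)) (ℚ.toℚᵘ-fromℚᵘ (mkℚᵘ (+ b) 0)) ⟩
  mkℚᵘ (+ a) 0 ℚᵘ.+ mkℚᵘ (+ b) 0            ≈⟨ *≡* numerators ⟩
  mkℚᵘ (+ (a + b)) 0                        ≈⟨ ℚ.toℚᵘ-fromℚᵘ (mkℚᵘ (+ (a + b)) 0) ⟨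
  toℚᵘ (fromℕ (a + b))                      ∎))
  where
  open ℚᵘ.≃-Reasoning
  numerators : (+ a ℤ.* + 1 ℤ.+ + b ℤ.* + 1) ℤ.* + 1 ≡ + (a + b) ℤ.* + 1
  numerators = cong (ℤ._* + 1) (trans (cong₂ ℤ._+_ (ℤ.*-identityʳ (+ a)) (ℤ.*-identityʳ (+ b))) (sym (ℤ.pos-+ a b)))

[d*x]/d≡x : ∀ d x → + (suc d * x) / suc d ≡ fromℕ x
[d*x]/d≡x d x = ℚ.fromℚᵘ-cong {mkℚᵘ (+ (suc d * x)) d} {mkℚᵘ (+ x) 0} (*≡* (begin
  + (suc d * x) ℤ.* + 1   ≡⟨ ℤ.*-identityʳ _ ⟩
  + (suc d * x)           ≡⟨ cong +_ (*-comm (suc d) x) ⟩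
  + (x * suc d)           ≡⟨ ℤ.pos-* x (suc d) ⟩
  + x ℤ.* + suc d         ∎))
  where open ≡-Reasoning

negOnePow-+-even : ∀ x k → negOnePow (x + (k + k)) ≡ negOnePow x
negOnePow-+-even x zero    = cong negOnePow (+-identityʳ x)
negOnePow-+-even x (suc k) = begin
  negOnePow (x + (suc k + suc k))        ≡⟨ cong negOnePow (x+[1+k+1+k]≡2+x+[k+k] x k) ⟩
  - - negOnePow (x + (k + k))            ≡⟨ ⁻¹-involutive (negOnePow (x + (k + k))) ⟩
  negOnePow (x + (k + k))                ≡⟨ negOnePow-+-even x k ⟩
  negOnePow x                            ∎
  where open ≡-Reasoning
        x+[1+k+1+k]≡2+x+[k+k] : ∀ x k → x + (suc k + suc k) ≡ suc (suc (x + (k + k)))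
        x+[1+k+1+k]≡2+x+[k+k] = solve-∀

fromℕ-+-parity : ∀ m c X → c + evenBit m ≡ oddBit m + X → fromℕ c ≡ negOnePow (suc m) ℚ.+ fromℕ X
fromℕ-+-parity zero c X c+1≡X = begin
  fromℕ c                           ≡⟨ ℚ.+-identityˡ (fromℕ c) ⟨
  0ℚ ℚ.+ fromℕ c                    ≡⟨ cong (ℚ._+ fromℕ c) (ℚ.+-inverseˡ 1ℚ) ⟨
  (- 1ℚ ℚ.+ 1ℚ) ℚ.+ fromℕ c         ≡⟨ ℚ.+-assoc (- 1ℚ) 1ℚ (fromℕ c) ⟩
  - 1ℚ ℚ.+ (1ℚ ℚ.+ fromℕ c)         ≡⟨ cong (- 1ℚ ℚ.+_) (fromℕ-+ 1 c) ⟨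
  - 1ℚ ℚ.+ fromℕ (1 + c)            ≡⟨ cong (λ x → - 1ℚ ℚ.+ fromℕ x) (trans (+-comm 1 c) c+1≡X) ⟩
  - 1ℚ ℚ.+ fromℕ X                  ∎
  where open ≡-Reasoning
fromℕ-+-parity (suc zero)    c X c≡1+X = trans (cong fromℕ (trans (sym (+-identityʳ c)) c≡1+X)) (fromℕ-+ 1 X)
fromℕ-+-parity (suc (suc m)) c X eq    = trans (fromℕ-+-parity m c X eq) (cong (ℚ._+ fromℕ X) (sym (⁻¹-involutive (negOnePow (suc m)))))

sumTo≡fromℕ∑≤ : ∀ m {f : ℕ → ℚ} {g : ℕ → ℕ} → (∀ i → i ≤ m → f i ≡ fromℕ (g i)) →
                sumTo m f ≡ fromℕ (∑≤ m g)
sumTo≡fromℕ∑≤ m {f} f≗g = trans (cong (foldr ℚ._+_ 0ℚ) (List.map-upTo f (suc m))) (foldr-applyUpTo m f≗g)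
  where
  foldr-applyUpTo : ∀ m {f : ℕ → ℚ} {g : ℕ → ℕ} → (∀ i → i ≤ m → f i ≡ fromℕ (g i)) →
    foldr ℚ._+_ 0ℚ (applyUpTo f (suc m)) ≡ fromℕ (∑≤ m g)
  foldr-applyUpTo zero    f≗g = trans (ℚ.+-identityʳ _) (f≗g 0 z≤n)
  foldr-applyUpTo (suc m) {f} {g} f≗g =
    trans (cong₂ ℚ._+_ (f≗g 0 z≤n) (foldr-applyUpTo m {f ∘ suc} {g ∘ suc} (λ i i≤m → f≗g (suc i) (s≤s i≤m))))
          (sym (fromℕ-+ (g 0) (∑≤ m (g ∘ suc))))

m≡n+o⇒m∸o≡n : ∀ {m n} o → m ≡ n + o → m ∸ o ≡ n
m≡n+o⇒m∸o≡n {n = n} o refl = m+n∸n≡m n o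

1+n%2≢n%2 : ∀ n → suc n % 2 ≢ n % 2
1+n%2≢n%2 zero          ()
1+n%2≢n%2 (suc zero)    ()
1+n%2≢n%2 (suc (suc n)) eq = 1+n%2≢n%2 n (begin
  suc n % 2          ≡⟨ [m+n]%n≡m%n (suc n) 2 ⟨
  (suc n + 2) % 2    ≡⟨ cong (_% 2) (+-comm (suc n) 2) ⟩
  suc (suc (suc n)) % 2 ≡⟨ eq ⟩
  suc (suc n) % 2    ≡⟨ cong (_% 2) (+-comm 2 n) ⟩
  (n + 2) % 2        ≡⟨ [m+n]%n≡m%n n 2 ⟩
  n % 2              ∎)
  where open ≡-Reasoning

private
  fraction : ℕ → ℕ → ℕ → ℕ → ℕ → ℕ → ℚ
  fraction k j A B c q = + ((2 * k + 2) * (A C j) * (B C c)) / suc q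

  fraction-cong : ∀ k j {A A′ B B′ c c′ q q′} → A ≡ A′ → B ≡ B′ → c ≡ c′ → q ≡ q′ →
                  fraction k j A B c q ≡ fraction k j A′ B′ c′ q′
  fraction-cong k j refl refl refl refl = refl

chi≡1 : ∀ k i j e → chi (suc (k + (i + i) + j + (e + e))) k j ≡ 1ℚ
chi≡1 k i j e = cong (λ b → if b then 1ℚ else 0ℚ) (dec-true (j % 2 ≟ _) (sym (begin
  (k + (i + i) + j + (e + e) + k) % 2 ≡⟨ cong (_% 2) (arith k i j e) ⟩
  (j + (k + i + e) * 2) % 2           ≡⟨ [m+kn]%n≡m%n j (k + i + e) 2 ⟩
  j % 2                               ∎)))
  where open ≡-Reasoning
        arith : ∀ k i j e → k + (i + i) + j + (e + e) + k ≡ j + (k + i + e) * 2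
        arith = solve-∀

chi≡0 : ∀ k i j e → chi (suc (k + (i + i) + j + suc (e + e))) k j ≡ 0ℚ
chi≡0 k i j e = cong (λ b → if b then 1ℚ else 0ℚ) (dec-false (j % 2 ≟ _) (λ eq → 1+n%2≢n%2 j (sym (begin
  j % 2                                   ≡⟨ eq ⟩
  (k + (i + i) + j + suc (e + e) + k) % 2 ≡⟨ cong (_% 2) (arith k i j e) ⟩
  (suc j + (k + i + e) * 2) % 2           ≡⟨ [m+kn]%n≡m%n (suc j) (k + i + e) 2 ⟩
  suc j % 2                               ∎))))
  where open ≡-Reasoning
        arith : ∀ k i j e → k + (i + i) + j + suc (e + e) + k ≡ suc j + (k + i + e) * 2
        arith = solve-∀

ballot-numerator : ∀ k e x → (2 * k + 2) * x * ((k + (e + e)) C (k + e)) ≡ suc (suc ((k + e) * 2)) * (x * dyck (k + (e + e)) k)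
ballot-numerator k e x = begin
  (2 * k + 2) * x * ((k + (e + e)) C (k + e))         ≡⟨ regroup k x _ ⟩
  2 * x * ((k + 1) * ((k + (e + e)) C (k + e)))       ≡⟨ cong (2 * x *_) (ballot e k refl) ⟨
  2 * x * ((k + e + 1) * dyck (k + (e + e)) k)        ≡⟨ regroup′ k e x _ ⟩
  suc (suc ((k + e) * 2)) * (x * dyck (k + (e + e)) k) ∎
  where open ≡-Reasoning
        regroup : ∀ k x y → (2 * k + 2) * x * y ≡ 2 * x * ((k + 1) * y)
        regroup = solve-∀
        regroup′ : ∀ k e x y → 2 * x * ((k + e + 1) * y) ≡ suc (suc ((k + e) * 2)) * (x * y)
        regroup′ = solve-∀

summand-even : ∀ k i j e → let n = suc (k + (i + i) + j + (e + e)) in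
  summand n k i j ≡ fromℕ (((k + (j + (e + e)) ∸ 1) C j) * dyck (k + (e + e)) k)
summand-even k i j e = begin
  chi n k j ℚ.* fraction k j (n ∸ 2 * i ∸ 2) (n ∸ 2 * i ∸ j ∸ 1) ((n + k ∸ j ∸ 1) ℕ./ 2 ∸ i) (n + k ∸ 2 * i ∸ j)
    ≡⟨ cong₂ ℚ._*_ (chi≡1 k i j e) (fraction-cong k j (cong (_∸ 2) n∸2i≡) B≡ c≡ q≡) ⟩
  1ℚ ℚ.* fraction k j (k + (j + (e + e)) ∸ 1) (k + (e + e)) (k + e) (suc ((k + e) * 2))
    ≡⟨ ℚ.*-identityˡ _ ⟩
  + ((2 * k + 2) * c₁ * ((k + (e + e)) C (k + e))) / suc (suc ((k + e) * 2))
    ≡⟨ cong (λ x → + x / suc (suc ((k + e) * 2))) (ballot-numerator k e c₁) ⟩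
  + (suc (suc ((k + e) * 2)) * (c₁ * dyck (k + (e + e)) k)) / suc (suc ((k + e) * 2))
    ≡⟨ [d*x]/d≡x (suc ((k + e) * 2)) (c₁ * dyck (k + (e + e)) k) ⟩
  fromℕ (c₁ * dyck (k + (e + e)) k) ∎
  where
  open ≡-Reasoning
  n c₁ : ℕ
  n = suc (k + (i + i) + j + (e + e))
  c₁ = (k + (j + (e + e)) ∸ 1) C j
  n∸2i≡ : n ∸ 2 * i ≡ suc (k + (j + (e + e)))
  n∸2i≡ = m≡n+o⇒m∸o≡n (2 * i) (arith k i j e)
    where arith : ∀ k i j e → suc (k + (i + i) + j + (e + e)) ≡ suc (k + (j + (e + e))) + 2 * i
          arith = solve-∀
  B≡ : n ∸ 2 * i ∸ j ∸ 1 ≡ k + (e + e)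
  B≡ = cong (_∸ 1) (trans (cong (_∸ j) n∸2i≡) (m≡n+o⇒m∸o≡n j (arith k j e)))
    where arith : ∀ k j e → suc (k + (j + (e + e))) ≡ suc (k + (e + e)) + j
          arith = solve-∀
  c≡ : (n + k ∸ j ∸ 1) ℕ./ 2 ∸ i ≡ k + e
  c≡ = begin
    (n + k ∸ j ∸ 1) ℕ./ 2 ∸ i   ≡⟨ cong (λ x → (x ∸ 1) ℕ./ 2 ∸ i) (m≡n+o⇒m∸o≡n j (arith k i j e)) ⟩
    (k + e + i) * 2 ℕ./ 2 ∸ i   ≡⟨ cong (_∸ i) (m*n/n≡m (k + e + i) 2) ⟩
    k + e + i ∸ i               ≡⟨ m+n∸n≡m (k + e) i ⟩
    k + e                       ∎
    where arith : ∀ k i j e → suc (k + (i + i) + j + (e + e) + k) ≡ suc ((k + e + i) * 2) + j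
          arith = solve-∀
  q≡ : n + k ∸ 2 * i ∸ j ≡ suc ((k + e) * 2)
  q≡ = m≡n+o⇒m∸o≡n j (m≡n+o⇒m∸o≡n (2 * i) (arith k i j e))
    where arith : ∀ k i j e → suc (k + (i + i) + j + (e + e) + k) ≡ suc ((k + e) * 2) + j + 2 * i
          arith = solve-∀

summand-odd : ∀ k i j e → let n = suc (k + (i + i) + j + suc (e + e)) in
  summand n k i j ≡ fromℕ (((k + (j + suc (e + e)) ∸ 1) C j) * dyck (k + suc (e + e)) k)
summand-odd k i j e = begin
  chi n k j ℚ.* rest                             ≡⟨ cong (ℚ._* rest) (chi≡0 k i j e) ⟩
  0ℚ ℚ.* rest                                    ≡⟨ ℚ.*-zeroˡ rest ⟩
  fromℕ 0                                        ≡⟨ cong fromℕ (*-zeroʳ c₁) ⟨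
  fromℕ (c₁ * 0)                                 ≡⟨ cong (λ x → fromℕ (c₁ * x)) (dyck-odd (k + suc (e + e)) k (e + k) (arith k e)) ⟨
  fromℕ (c₁ * dyck (k + suc (e + e)) k)          ∎
  where
  open ≡-Reasoning
  n c₁ : ℕ
  n = suc (k + (i + i) + j + suc (e + e))
  c₁ = (k + (j + suc (e + e)) ∸ 1) C j
  rest : ℚ
  rest = fraction k j (n ∸ 2 * i ∸ 2) (n ∸ 2 * i ∸ j ∸ 1) ((n + k ∸ j ∸ 1) ℕ./ 2 ∸ i) (n + k ∸ 2 * i ∸ j)
  arith : ∀ k e → k + suc (e + e) + k ≡ suc (e + k + (e + k))
  arith = solve-∀

even⊎odd : ∀ d → ∃[ e ] (d ≡ e + e ⊎ d ≡ suc (e + e))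
even⊎odd zero = 0 , inj₁ refl
even⊎odd (suc d) with even⊎odd d
... | e , inj₁ d≡2e   = e , inj₂ (cong suc d≡2e)
... | e , inj₂ d≡2e+1 = suc e , inj₁ (trans (cong suc d≡2e+1) (cong suc (sym (+-suc e e))))

summand≡fromℕ : ∀ k i j d →
  summand (suc (k + (i + i) + j + d)) k i j ≡ fromℕ (((k + (j + d) ∸ 1) C j) * dyck (k + d) k)
summand≡fromℕ k i j d with even⊎odd d
... | e , inj₁ refl = summand-even k i j e
... | e , inj₂ refl = summand-odd k i j e

n/2≡⌊n/2⌋ : ∀ n → n ℕ./ 2 ≡ ⌊ n /2⌋
n/2≡⌊n/2⌋ zero          = refl
n/2≡⌊n/2⌋ (suc zero)    = refl
n/2≡⌊n/2⌋ (suc (suc n)) = trans (m/n≡1+[m∸n]/n {suc (suc n)} {2} (s≤s (s≤s z≤n))) (cong suc (n/2≡⌊n/2⌋ n))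

i≤⌊m/2⌋⇒i+i≤m : ∀ {i} m → i ≤ ⌊ m /2⌋ → i + i ≤ m
i≤⌊m/2⌋⇒i+i≤m m i≤⌊m/2⌋ =
  ≤-trans (+-mono-≤ i≤⌊m/2⌋ (≤-trans i≤⌊m/2⌋ (⌊n/2⌋≤⌈n/2⌉ m))) (≤-reflexive (⌊n/2⌋+⌈n/2⌉≡n m))

1+k+m∸k∸1≡m : ∀ k m → suc (k + m) ∸ k ∸ 1 ≡ m
1+k+m∸k∸1≡m k m = cong (_∸ 1) (m≡n+o⇒m∸o≡n k (cong suc (+-comm k m)))

inner-sum≡Δmotzkin : ∀ k m i → i + i ≤ m →
  sumTo (suc (k + m) ∸ k ∸ 1 ∸ 2 * i) (summand (suc (k + m)) k i) ≡ fromℕ (Δmotzkin k (m ∸ (i + i)))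
inner-sum≡Δmotzkin k m i 2i≤m = trans (cong (λ l → sumTo l (summand (suc (k + m)) k i)) upper≡) (sumTo≡fromℕ∑≤ a term≡)
  where
  a : ℕ
  a = m ∸ (i + i)
  upper≡ : suc (k + m) ∸ k ∸ 1 ∸ 2 * i ≡ a
  upper≡ = cong₂ _∸_ (1+k+m∸k∸1≡m k m) (cong (λ x → i + x) (+-identityʳ i))
  term≡ : ∀ j → j ≤ a → summand (suc (k + m)) k i j ≡ fromℕ (((k + a ∸ 1) C j) * dyck (k + a ∸ j) k)
  term≡ j j≤a = begin
    summand (suc (k + m)) k i j
      ≡⟨ cong (λ x → summand (suc x) k i j) k+m≡ ⟩
    summand (suc (k + (i + i) + j + (a ∸ j))) k i j
      ≡⟨ summand≡fromℕ k i j (a ∸ j) ⟩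
    fromℕ (((k + (j + (a ∸ j)) ∸ 1) C j) * dyck (k + (a ∸ j)) k)
      ≡⟨ cong₂ (λ x y → fromℕ (((k + x ∸ 1) C j) * dyck y k)) (m+[n∸m]≡n j≤a) (sym (+-∸-assoc k j≤a)) ⟩
    fromℕ (((k + a ∸ 1) C j) * dyck (k + a ∸ j) k) ∎
    where
    open ≡-Reasoning
    k+m≡ : k + m ≡ k + (i + i) + j + (a ∸ j)
    k+m≡ = begin
      k + m                           ≡⟨ cong (λ x → k + x) (m+[n∸m]≡n 2i≤m) ⟨
      k + (i + i + a)                 ≡⟨ cong (λ x → k + (i + i + x)) (m+[n∸m]≡n j≤a) ⟨
      k + (i + i + (j + (a ∸ j)))     ≡⟨ assoc k (i + i) j (a ∸ j) ⟩
      k + (i + i) + j + (a ∸ j)       ∎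
      where assoc : ∀ k p j q → k + (p + (j + q)) ≡ k + p + j + q
            assoc = solve-∀

rhs-as-alternating-sum : ∀ k m →
  rhs (suc (k + m)) k ≡ negOnePow (suc m) ℚ.+ fromℕ (∑[ i ≤ ⌊ m /2⌋ ] Δmotzkin k (m ∸ (i + i)))
rhs-as-alternating-sum k m = cong₂ ℚ._+_ sign≡ (trans (cong (λ l → sumTo l outer) upper≡)
  (sumTo≡fromℕ∑≤ ⌊ m /2⌋ (λ i i≤⌊m/2⌋ → inner-sum≡Δmotzkin k m i (i≤⌊m/2⌋⇒i+i≤m m i≤⌊m/2⌋))))
  where
  outer : ℕ → ℚ
  outer i = sumTo (suc (k + m) ∸ k ∸ 1 ∸ 2 * i) (summand (suc (k + m)) k i)
  sign≡ : negOnePow (suc (k + m) + k) ≡ negOnePow (suc m)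
  sign≡ = trans (cong negOnePow (arith k m)) (negOnePow-+-even (suc m) k)
    where arith : ∀ k m → suc (k + m) + k ≡ suc m + (k + k)
          arith = solve-∀
  upper≡ : (suc (k + m) ∸ k ∸ 1) ℕ./ 2 ≡ ⌊ m /2⌋
  upper≡ = trans (cong (ℕ._/ 2) (1+k+m∸k∸1≡m k m)) (n/2≡⌊n/2⌋ m)

hookCount≡rhs : ∀ k m → fromℕ (hookCount (suc (k + m)) k) ≡ rhs (suc (k + m)) k
hookCount≡rhs k m = trans (fromℕ-+-parity m _ _ (hookCount-alternating k m)) (sym (rhs-as-alternating-sum k m))

-- Hook tableaux with reversed rows

occ-accept : ∀ w xs → occ w (w ∷ xs) ≡ suc (occ w xs)
occ-accept w xs = cong length (List.filter-accept (_≟ w) refl)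

occ-reject : ∀ {w x} xs → x ≢ w → occ w (x ∷ xs) ≡ occ w xs
occ-reject {w} xs x≢w = cong length (List.filter-reject (_≟ w) x≢w)

occ≡0 : ∀ {w xs} → All (_≢ w) xs → occ w xs ≡ 0
occ≡0 []                       = refl
occ≡0 {xs = _ ∷ xs} (x≢w ∷ ps) = trans (occ-reject xs x≢w) (occ≡0 ps)

occ≡0⁻ : ∀ {w} xs → occ w xs ≡ 0 → All (_≢ w) xs
occ≡0⁻     []       _  = []
occ≡0⁻ {w} (x ∷ xs) eq with x ≟ w
... | yes refl = contradiction (trans (sym (occ-accept w xs)) eq) λ ()
... | no  x≢w  = x≢w ∷ occ≡0⁻ xs (trans (sym (occ-reject xs x≢w)) eq)

occ-↭ : ∀ {w xs ys} → xs ↭ ys → occ w xs ≡ occ w ys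
occ-↭ {w} xs↭ys = ↭-length (filter-↭ (_≟ w) xs↭ys)

All-1…n⁻ : ∀ {P : ℕ → Set} n → All P (map suc (upTo n)) → ∀ {w} → 1 ≤ w → w ≤ n → P w
All-1…n⁻ n ps {suc w} _ w<n = All.applyUpTo⁻ id n (All.map⁻ ps) w<n

All-1…n⁺ : ∀ {P : ℕ → Set} n → (∀ {w} → 1 ≤ w → w ≤ n → P w) → All P (map suc (upTo n))
All-1…n⁺ n f = All.map⁺ (All.applyUpTo⁺₁ id n (f (s≤s z≤n)))

InRange : ℕ → ℕ → Set
InRange n x = 1 ≤ x × x ≤ n

Enumerates : ℕ → List ℕ → Set
Enumerates n L = All (InRange n) L × All (λ w → occ w L ≡ 1) (map suc (upTo n)) × length L ≡ n

×-irrelevant : ∀ {A B : Set} → Irrelevant A → Irrelevant B → Irrelevant (A × B)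
×-irrelevant irrA irrB (a , b) (a′ , b′) = cong₂ _,_ (irrA a a′) (irrB b b′)

Σ-≡ : ∀ {A : Set} {P : A → Set} → (∀ a → Irrelevant (P a)) →
      ∀ {a b} {p : P a} {q : P b} → a ≡ b → _≡_ {A = Σ A P} (a , p) (b , q)
Σ-≡ irr {a} refl = cong (a ,_) (irr a _ _)

Enumerates-irrelevant : ∀ n L → Irrelevant (Enumerates n L)
Enumerates-irrelevant n L =
  ×-irrelevant (All.irrelevant (×-irrelevant ≤-irrelevant ≤-irrelevant))
               (×-irrelevant (All.irrelevant ≡-irrelevant) ≡-irrelevant)

Enumerates-insert : ∀ {n L L′} → L′ ↭ suc n ∷ L → Enumerates n L → Enumerates (suc n) L′
Enumerates-insert {n} {L} {L′} L′↭ (inRange , once , len) =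
  All-resp-↭ (↭-sym L′↭) ((s≤s z≤n , ≤-refl) ∷ All.map (λ (1≤x , x≤n) → 1≤x , m≤n⇒m≤1+n x≤n) inRange) ,
  All-1…n⁺ (suc n) once′ ,
  trans (↭-length L′↭) (cong suc len)
  where
  once′ : ∀ {w} → 1 ≤ w → w ≤ suc n → occ w L′ ≡ 1
  once′ {w} 1≤w w≤1+n with w ≟ suc n
  ... | yes refl = trans (occ-↭ L′↭) (trans (occ-accept (suc n) L)
                     (cong suc (occ≡0 (All.map (λ (_ , x≤n) → <⇒≢ (s≤s x≤n)) inRange))))
  ... | no  w≢1+n = trans (occ-↭ L′↭) (trans (occ-reject L (≢-sym w≢1+n))
                      (All-1…n⁻ n once 1≤w (≤-pred (≤∧≢⇒< w≤1+n w≢1+n))))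

Enumerates-remove : ∀ {n L L′} → L′ ↭ suc n ∷ L → Enumerates (suc n) L′ → Enumerates n L
Enumerates-remove {n} {L} {L′} L′↭ (inRange , once , len) =
  All.zipWith inRange′ (All.++⁻ʳ [ suc n ] (All-resp-↭ L′↭ inRange) , occ≡0⁻ L occ[1+n]≡0) ,
  All-1…n⁺ n once′ ,
  suc-injective (trans (sym (↭-length L′↭)) len)
  where
  inRange′ : ∀ {x} → InRange (suc n) x × x ≢ suc n → InRange n x
  inRange′ ((1≤x , x≤1+n) , x≢1+n) = 1≤x , ≤-pred (≤∧≢⇒< x≤1+n x≢1+n)
  once′ : ∀ {w} → 1 ≤ w → w ≤ n → occ w L ≡ 1
  once′ 1≤w w≤n = trans (sym (occ-reject L (>⇒≢ (s≤s w≤n))))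
                    (trans (sym (occ-↭ L′↭)) (All-1…n⁻ (suc n) once 1≤w (m≤n⇒m≤1+n w≤n)))
  occ[1+n]≡0 : occ (suc n) L ≡ 0
  occ[1+n]≡0 = suc-injective (trans (sym (occ-accept (suc n) L))
                 (trans (sym (occ-↭ L′↭)) (All-1…n⁻ (suc n) once (s≤s z≤n) ≤-refl)))

Enumerates-max : ∀ {n L} → Enumerates (suc n) L → ¬ All (_< suc n) L
Enumerates-max {n} {L} (_ , once , _) all< =
  0≢1+n (trans (sym (occ≡0 (All.map (λ x<1+n → <⇒≢ x<1+n) all<))) (All-1…n⁻ (suc n) once (s≤s z≤n) ≤-refl))

Triple : Set
Triple = List ℕ × List ℕ × List ℕ

last⁺ : ℕ → List ℕ → ℕ
last⁺ x []       = x
last⁺ _ (y ∷ ys) = last⁺ y ys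

All-last⁺ : ∀ {P : ℕ → Set} {x} xs → All P (x ∷ xs) → P (last⁺ x xs)
All-last⁺ []       (px ∷ _)   = px
All-last⁺ (y ∷ ys) (_ ∷ pys) = All-last⁺ ys pys

FirstColumn : List ℕ → List ℕ → Set
FirstColumn _        []      = ⊤
FirstColumn []       (_ ∷ _) = ⊥
FirstColumn (x ∷ R₁) (c ∷ V) = last⁺ x R₁ < last⁺ c V

-- A hook tableau is stored as its first row R₀, its second row R₁ and the part V of its
-- first column below row 2, each read backwards, so that the largest entry heads its list.
-- h = λ₁ − λ₂, and the flag records whether the second row is empty.
record IsHook (n h : ℕ) (oneRow : Bool) (R₀ R₁ V : List ℕ) : Set where
  constructor isHook
  field
    row₀-desc : Linked _>_ R₀
    row₁-desc : Linked _>_ R₁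
    col-desc  : Linked _>_ V
    entries   : Enumerates n (R₀ ++ R₁ ++ V)
    excess    : length R₀ ≡ length R₁ + h
    columns   : All (uncurry _>_) (zip R₁ (drop h R₀))
    corner    : FirstColumn R₁ V
    row₁-null : null R₁ ≡ oneRow

open IsHook

Hook : ℕ → ℕ → Bool → Set
Hook n h oneRow = Σ Triple λ (R₀ , R₁ , V) → IsHook n h oneRow R₀ R₁ V

module _ {n h b R₀ R₁ V} (p : IsHook n h b R₀ R₁ V) where

  row₀≤ : All (_≤ n) R₀
  row₀≤ = All.map proj₂ (All.++⁻ˡ R₀ (proj₁ (entries p)))

  row₁≤ : All (_≤ n) R₁
  row₁≤ = All.map proj₂ (All.++⁻ˡ R₁ (All.++⁻ʳ R₀ (proj₁ (entries p))))

  col≤ : All (_≤ n) V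
  col≤ = All.map proj₂ (All.++⁻ʳ R₁ (All.++⁻ʳ R₀ (proj₁ (entries p))))

  row₀< : All (_< suc n) R₀
  row₀< = All.map s≤s row₀≤

  row₁< : All (_< suc n) R₁
  row₁< = All.map s≤s row₁≤

  col< : All (_< suc n) V
  col< = All.map s≤s col≤

FirstColumn-irrelevant : ∀ R₁ V → Irrelevant (FirstColumn R₁ V)
FirstColumn-irrelevant _        []      tt tt = refl
FirstColumn-irrelevant (x ∷ R₁) (c ∷ V) p  q  = <-irrelevant p q

IsHook-irrelevant : ∀ {n h b R₀ R₁ V} → Irrelevant (IsHook n h b R₀ R₁ V)
IsHook-irrelevant {n} {R₀ = R₀} {R₁} {V} (isHook a₀ a₁ a₂ a₃ a₄ a₅ a₆ a₇) (isHook b₀ b₁ b₂ b₃ b₄ b₅ b₆ b₇)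
  with Linked.irrelevant <-irrelevant a₀ b₀ | Linked.irrelevant <-irrelevant a₁ b₁
     | Linked.irrelevant <-irrelevant a₂ b₂ | Enumerates-irrelevant n (R₀ ++ R₁ ++ V) a₃ b₃
     | ≡-irrelevant a₄ b₄ | All.irrelevant <-irrelevant a₅ b₅
     | FirstColumn-irrelevant R₁ V a₆ b₆ | Decidable⇒UIP.≡-irrelevant Bool._≟_ a₇ b₇
... | refl | refl | refl | refl | refl | refl | refl | refl = refl

Hook-≡ : ∀ {n h b} {t t′ : Triple} {p q} → t ≡ t′ → _≡_ {A = Hook n h b} (t , p) (t′ , q)
Hook-≡ = Σ-≡ (λ _ → IsHook-irrelevant)

linked-∷ : ∀ {v R} → Linked _>_ R → All (_< v) R → Linked _>_ (v ∷ R)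
linked-∷ {R = []}    _ _         = [-]
linked-∷ {R = _ ∷ _} l (x<v ∷ _) = x<v ∷ l

linked⇒All< : ∀ {x R} → Linked _>_ (x ∷ R) → All (_< x) R
linked⇒All< [-]       = []
linked⇒All< (x>y ∷ l) = Linked⇒All (λ x>y y>z → <-trans y>z x>y) x>y l

drop-∷ : ∀ h (xs : List ℕ) → h < length xs → Σ ℕ λ x → drop h xs ≡ x ∷ drop (suc h) xs
drop-∷ zero    (x ∷ xs) _         = x , refl
drop-∷ (suc h) (x ∷ xs) (s≤s h<n) = drop-∷ h xs h<n

All-zip-drop : ∀ {P : ℕ × ℕ → Set} h a R (X : List ℕ) → All P (zip (a ∷ R) (drop h X)) → All P (zip R (drop (suc h) X))
All-zip-drop {P} zero    a R []      _        = subst (All P) (sym (List.zipWith-zeroʳ _,_ R)) []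
All-zip-drop     zero    a R (x ∷ X) (_ ∷ ps) = ps
All-zip-drop {P} (suc h) a R []      _        = subst (All P) (sym (List.zipWith-zeroʳ _,_ R)) []
All-zip-drop     (suc h) a R (x ∷ X) ps       = All-zip-drop h a R X ps

shift-past-rows : ∀ {v} (R₀ R₁ V : List ℕ) → R₀ ++ R₁ ++ v ∷ V ↭ v ∷ R₀ ++ R₁ ++ V
shift-past-rows {v} R₀ R₁ V =
  subst₂ _↭_ (List.++-assoc R₀ R₁ (v ∷ V)) (cong (v ∷_) (List.++-assoc R₀ R₁ V)) (shift v (R₀ ++ R₁) V)

module _ {n h : ℕ} {R₀ R₁ V : List ℕ} where

  insert₀ : ∀ {b} → IsHook n h b R₀ R₁ V → IsHook (suc n) (suc h) b (suc n ∷ R₀) R₁ V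
  insert₀ p = record
    { row₀-desc = linked-∷ (row₀-desc p) (row₀< p)
    ; row₁-desc = row₁-desc p
    ; col-desc  = col-desc p
    ; entries   = Enumerates-insert ↭-refl (entries p)
    ; excess    = trans (cong suc (excess p)) (sym (+-suc _ h))
    ; columns   = columns p
    ; corner    = corner p
    ; row₁-null = row₁-null p
    }

  remove₀ : ∀ {b} → IsHook (suc n) (suc h) b (suc n ∷ R₀) R₁ V → IsHook n h b R₀ R₁ V
  remove₀ p = record
    { row₀-desc = Linked.tail (row₀-desc p)
    ; row₁-desc = row₁-desc p
    ; col-desc  = col-desc p
    ; entries   = Enumerates-remove ↭-refl (entries p)
    ; excess    = suc-injective (trans (excess p) (+-suc _ h))
    ; columns   = columns p
    ; corner    = corner p
    ; row₁-null = row₁-null p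
    }

  insert₁ : ∀ {b} → IsHook n (suc h) b R₀ R₁ V → IsHook (suc n) h false R₀ (suc n ∷ R₁) V
  insert₁ p = record
    { row₀-desc = row₀-desc p
    ; row₁-desc = linked-∷ (row₁-desc p) (row₁< p)
    ; col-desc  = col-desc p
    ; entries   = Enumerates-insert (shift (suc n) R₀ (R₁ ++ V)) (entries p)
    ; excess    = trans (excess p) (+-suc _ h)
    ; columns   = subst (λ X → All (uncurry _>_) (zip (suc n ∷ R₁) X)) (sym drop-h≡) (s≤s x≤n ∷ columns p)
    ; corner    = corner′ R₁ V (corner p)
    ; row₁-null = refl
    }
    where
    h<len : h < length R₀
    h<len = subst (h <_) (sym (excess p)) (≤-trans (s≤s (m≤n+m h (length R₁))) (≤-reflexive (sym (+-suc _ h))))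
    x : ℕ
    x = proj₁ (drop-∷ h R₀ h<len)
    drop-h≡ : drop h R₀ ≡ x ∷ drop (suc h) R₀
    drop-h≡ = proj₂ (drop-∷ h R₀ h<len)
    x≤n : x ≤ n
    x≤n with subst (All (_≤ n)) drop-h≡ (All.drop⁺ h (row₀≤ p))
    ... | x≤n ∷ _ = x≤n
    corner′ : ∀ R₁ V → FirstColumn R₁ V → FirstColumn (suc n ∷ R₁) V
    corner′ _       []      _ = tt
    corner′ (_ ∷ _) (_ ∷ _) y<c = y<c

  remove₁ : ∀ {b} → IsHook (suc n) h b R₀ (suc n ∷ R₁) V → IsHook n (suc h) (null R₁) R₀ R₁ V
  remove₁ p = record
    { row₀-desc = row₀-desc p
    ; row₁-desc = Linked.tail (row₁-desc p)
    ; col-desc  = col-desc p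
    ; entries   = Enumerates-remove (shift (suc n) R₀ (R₁ ++ V)) (entries p)
    ; excess    = trans (excess p) (sym (+-suc _ h))
    ; columns   = All-zip-drop h (suc n) R₁ R₀ (columns p)
    ; corner    = corner′ R₁ V (col≤ p) (corner p)
    ; row₁-null = refl
    }
    where
    corner′ : ∀ R₁ V → All (_≤ suc n) V → FirstColumn (suc n ∷ R₁) V → FirstColumn R₁ V
    corner′ _       []      _     _ = tt
    corner′ []      (_ ∷ V) V≤1+n 1+n<c = <-irrefl refl (<-≤-trans 1+n<c (All-last⁺ V V≤1+n))
    corner′ (_ ∷ _) (_ ∷ _) _     y<c   = y<c

  insert-col : IsHook n h false R₀ R₁ V → IsHook (suc n) h false R₀ R₁ (suc n ∷ V)
  insert-col p = record
    { row₀-desc = row₀-desc p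
    ; row₁-desc = row₁-desc p
    ; col-desc  = linked-∷ (col-desc p) (col< p)
    ; entries   = Enumerates-insert (shift-past-rows R₀ R₁ V) (entries p)
    ; excess    = excess p
    ; columns   = columns p
    ; corner    = corner′ R₁ V (row₁-null p) (row₁≤ p) (corner p)
    ; row₁-null = row₁-null p
    }
    where
    corner′ : ∀ R₁ V → null R₁ ≡ false → All (_≤ n) R₁ → FirstColumn R₁ V → FirstColumn R₁ (suc n ∷ V)
    corner′ (y ∷ R₁) []      _ R₁≤n _ = s≤s (All-last⁺ R₁ R₁≤n)
    corner′ (_ ∷ _)  (_ ∷ _) _ _    y<c = y<c

  remove-col : ∀ {b} → IsHook (suc n) h b R₀ R₁ (suc n ∷ V) → IsHook n h false R₀ R₁ V
  remove-col p = record
    { row₀-desc = row₀-desc p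
    ; row₁-desc = row₁-desc p
    ; col-desc  = Linked.tail (col-desc p)
    ; entries   = Enumerates-remove (shift-past-rows R₀ R₁ V) (entries p)
    ; excess    = excess p
    ; columns   = columns p
    ; corner    = proj₁ (corner′ R₁ V (corner p))
    ; row₁-null = proj₂ (corner′ R₁ V (corner p))
    }
    where
    corner′ : ∀ R₁ V → FirstColumn R₁ (suc n ∷ V) → FirstColumn R₁ V × null R₁ ≡ false
    corner′ (_ ∷ _) []      _ = tt , refl
    corner′ (_ ∷ _) (_ ∷ _) y<c = y<c , refl

¬row₀-at-excess-0 : ∀ {n b R₀ R₁ V} → ¬ IsHook (suc n) 0 b (suc n ∷ R₀) R₁ V
¬row₀-at-excess-0 {R₁ = []}     p with () ← excess p
¬row₀-at-excess-0 {R₁ = _ ∷ _} p with columns p | row₁≤ p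
... | 1+n<y ∷ _ | y≤1+n ∷ _ = <-irrefl refl (<-≤-trans 1+n<y y≤1+n)

data HeadView (v : ℕ) : List ℕ → Set where
  starts : ∀ R → HeadView v (v ∷ R)
  below  : ∀ {R} → All (_< v) R → HeadView v R

headView : ∀ {v R} → Linked _>_ R → All (_≤ v) R → HeadView v R
headView {v} {[]}    _ _ = below []
headView {v} {x ∷ R} l (x≤v ∷ _) with x ≟ v
... | yes refl = starts R
... | no  x≢v  = below (x<v ∷ All.map (λ y<x → <-trans y<x x<v) (linked⇒All< l))
  where x<v = ≤∧≢⇒< x≤v x≢v

data LargestIn (v : ℕ) : List ℕ → List ℕ → List ℕ → Set where
  row₀ : ∀ {R₀ R₁ V} → LargestIn v (v ∷ R₀) R₁ V
  row₁ : ∀ {R₀ R₁ V} → All (_< v) R₀ → LargestIn v R₀ (v ∷ R₁) V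
  col  : ∀ {R₀ R₁ V} → All (_< v) R₀ → All (_< v) R₁ → LargestIn v R₀ R₁ (v ∷ V)

largestIn : ∀ {n h b R₀ R₁ V} → IsHook (suc n) h b R₀ R₁ V → LargestIn (suc n) R₀ R₁ V
largestIn p =
  locate (headView (row₀-desc p) (row₀≤ p)) (headView (row₁-desc p) (row₁≤ p)) (headView (col-desc p) (col≤ p)) (entries p)
  where
  locate : ∀ {n R₀ R₁ V} → HeadView (suc n) R₀ → HeadView (suc n) R₁ → HeadView (suc n) V →
           Enumerates (suc n) (R₀ ++ R₁ ++ V) → LargestIn (suc n) R₀ R₁ V
  locate (starts _) _          _          _ = row₀
  locate (below a)  (starts _) _          _ = row₁ a
  locate (below a)  (below b)  (starts _) _ = col a b
  locate (below a)  (below b)  (below c)  e = ⊥-elim (Enumerates-max e (All.++⁺ a (All.++⁺ b c)))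

LargestIn-irrelevant : ∀ {v R₀ R₁ V} → Irrelevant (LargestIn v R₀ R₁ V)
LargestIn-irrelevant row₀      row₀                = refl
LargestIn-irrelevant row₀      (row₁ (v<v ∷ _))    = ⊥-elim (<-irrefl refl v<v)
LargestIn-irrelevant row₀      (col (v<v ∷ _) _)   = ⊥-elim (<-irrefl refl v<v)
LargestIn-irrelevant (row₁ (v<v ∷ _)) row₀         = ⊥-elim (<-irrefl refl v<v)
LargestIn-irrelevant (row₁ a)  (row₁ a′)           = cong row₁ (All.irrelevant <-irrelevant a a′)
LargestIn-irrelevant (row₁ _)  (col _ (v<v ∷ _))   = ⊥-elim (<-irrefl refl v<v)
LargestIn-irrelevant (col (v<v ∷ _) _) row₀        = ⊥-elim (<-irrefl refl v<v)
LargestIn-irrelevant (col _ (v<v ∷ _)) (row₁ _)    = ⊥-elim (<-irrefl refl v<v)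
LargestIn-irrelevant (col a b) (col a′ b′)         =
  cong₂ col (All.irrelevant <-irrelevant a a′) (All.irrelevant <-irrelevant b b′)

AfterRow₀ : Bool → ℕ → ℕ → Set
AfterRow₀ b n zero    = ⊥
AfterRow₀ b n (suc h) = Hook n h b

AfterRow₁OrCol : ℕ → ℕ → Set
AfterRow₁OrCol n h = (Hook n (suc h) true ⊎ Hook n (suc h) false) ⊎ Hook n h false

AfterRemoval : ℕ → ℕ → Set
AfterRemoval n h = AfterRow₀ false n h ⊎ AfterRow₁OrCol n h

module _ {n : ℕ} where

  removeOneRow : ∀ {h R₀ R₁ V} → LargestIn (suc n) R₀ R₁ V → IsHook (suc n) h true R₀ R₁ V → AfterRow₀ true n h
  removeOneRow {zero}  row₀                 p = ¬row₀-at-excess-0 p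
  removeOneRow {suc h} (row₀ {R₀} {R₁} {V}) p = (R₀ , R₁ , V) , remove₀ p
  removeOneRow (row₁ _) p with () ← row₁-null p
  removeOneRow {R₁ = []}    (col _ _) p with () ← corner p
  removeOneRow {R₁ = _ ∷ _} (col _ _) p with () ← row₁-null p

  addOneRow : ∀ {h} → AfterRow₀ true n h → Hook (suc n) h true
  addOneRow {suc h} ((R₀ , R₁ , V) , q) = (suc n ∷ R₀ , R₁ , V) , insert₀ q

  removeOneRow∘addOneRow : ∀ {h} (y : AfterRow₀ true n h) → removeOneRow (largestIn (proj₂ (addOneRow y))) (proj₂ (addOneRow y)) ≡ y
  removeOneRow∘addOneRow {suc h} ((R₀ , R₁ , V) , q) =
    trans (cong (λ ℓ → removeOneRow ℓ (insert₀ q)) (LargestIn-irrelevant (largestIn (insert₀ q)) row₀)) (Hook-≡ refl)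

  addOneRow∘removeOneRow : ∀ {h R₀ R₁ V} (ℓ : LargestIn (suc n) R₀ R₁ V) (p : IsHook (suc n) h true R₀ R₁ V) →
                           addOneRow (removeOneRow ℓ p) ≡ ((R₀ , R₁ , V) , p)
  addOneRow∘removeOneRow {zero}  row₀ p = ⊥-elim (¬row₀-at-excess-0 p)
  addOneRow∘removeOneRow {suc h} row₀ p = Hook-≡ refl
  addOneRow∘removeOneRow (row₁ _) p with () ← row₁-null p
  addOneRow∘removeOneRow {R₁ = []}    (col _ _) p with () ← corner p
  addOneRow∘removeOneRow {R₁ = _ ∷ _} (col _ _) p with () ← row₁-null p

  oneRow↔AfterRow₀ : ∀ {h} → Hook (suc n) h true ↔ AfterRow₀ true n h
  oneRow↔AfterRow₀ = mk↔ₛ′ (λ (_ , p) → removeOneRow (largestIn p) p) addOneRow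
                       removeOneRow∘addOneRow (λ (_ , p) → addOneRow∘removeOneRow (largestIn p) p)

  classify : ∀ {h} R₀ R₁ V → IsHook n h (null R₁) R₀ R₁ V → Hook n h true ⊎ Hook n h false
  classify R₀ []       V q = inj₁ ((R₀ , [] , V) , q)
  classify R₀ (x ∷ R₁) V q = inj₂ ((R₀ , x ∷ R₁ , V) , q)

  removeHook : ∀ {h R₀ R₁ V} → LargestIn (suc n) R₀ R₁ V → IsHook (suc n) h false R₀ R₁ V → AfterRemoval n h
  removeHook (row₁ {R₀} {R₁} {V} _)  p = inj₂ (inj₁ (classify R₀ R₁ V (remove₁ p)))
  removeHook (col {R₀} {R₁} {V} _ _) p = inj₂ (inj₂ ((R₀ , R₁ , V) , remove-col p))
  removeHook {zero}  row₀               p = ⊥-elim (¬row₀-at-excess-0 p)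
  removeHook {suc h} (row₀ {R₀} {R₁} {V}) p = inj₁ ((R₀ , R₁ , V) , remove₀ p)

  addHook : ∀ {h} → AfterRemoval n h → Hook (suc n) h false
  addHook (inj₂ (inj₁ (inj₁ ((R₀ , R₁ , V) , q)))) = (R₀ , suc n ∷ R₁ , V) , insert₁ q
  addHook (inj₂ (inj₁ (inj₂ ((R₀ , R₁ , V) , q)))) = (R₀ , suc n ∷ R₁ , V) , insert₁ q
  addHook (inj₂ (inj₂ ((R₀ , R₁ , V) , q)))        = (R₀ , R₁ , suc n ∷ V) , insert-col q
  addHook {suc h} (inj₁ ((R₀ , R₁ , V) , q))       = (suc n ∷ R₀ , R₁ , V) , insert₀ q

  removeHook-at : ∀ {h R₀ R₁ V} (p : IsHook (suc n) h false R₀ R₁ V) (ℓ : LargestIn (suc n) R₀ R₁ V) →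
                  removeHook (largestIn p) p ≡ removeHook ℓ p
  removeHook-at p ℓ = cong (λ ℓ′ → removeHook ℓ′ p) (LargestIn-irrelevant (largestIn p) ℓ)

  removeHook∘addHook : ∀ {h} (y : AfterRemoval n h) → removeHook (largestIn (proj₂ (addHook y))) (proj₂ (addHook y)) ≡ y
  removeHook∘addHook {suc h} (inj₁ (_ , q)) =
    trans (removeHook-at (insert₀ q) row₀) (cong inj₁ (Hook-≡ refl))
  removeHook∘addHook (inj₂ (inj₁ (inj₁ ((_ , [] , _) , q)))) =
    trans (removeHook-at (insert₁ q) (row₁ (row₀< q))) (cong (inj₂ ∘ inj₁ ∘ inj₁) (Hook-≡ refl))
  removeHook∘addHook (inj₂ (inj₁ (inj₂ ((_ , _ ∷ _ , _) , q)))) =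
    trans (removeHook-at (insert₁ q) (row₁ (row₀< q))) (cong (inj₂ ∘ inj₁ ∘ inj₂) (Hook-≡ refl))
  removeHook∘addHook (inj₂ (inj₂ (_ , q))) =
    trans (removeHook-at (insert-col q) (col (row₀< q) (row₁< q))) (cong (inj₂ ∘ inj₂) (Hook-≡ refl))
  removeHook∘addHook (inj₂ (inj₁ (inj₁ ((_ , _ ∷ _ , _) , q)))) with () ← row₁-null q
  removeHook∘addHook (inj₂ (inj₁ (inj₂ ((_ , [] , _) , q))))    with () ← row₁-null q

  addHook∘removeHook : ∀ {h R₀ R₁ V} (ℓ : LargestIn (suc n) R₀ R₁ V) (p : IsHook (suc n) h false R₀ R₁ V) →
                       addHook (removeHook ℓ p) ≡ ((R₀ , R₁ , V) , p)
  addHook∘removeHook {zero}               row₀      p = ⊥-elim (¬row₀-at-excess-0 p)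
  addHook∘removeHook {suc h}              row₀      p = Hook-≡ refl
  addHook∘removeHook {R₁ = _ ∷ []}        (row₁ _)  p = Hook-≡ refl
  addHook∘removeHook {R₁ = _ ∷ _ ∷ _}     (row₁ _)  p = Hook-≡ refl
  addHook∘removeHook                      (col _ _) p = Hook-≡ refl

  hook↔AfterRemoval : ∀ {h} → Hook (suc n) h false ↔ AfterRemoval n h
  hook↔AfterRemoval = mk↔ₛ′ (λ (_ , p) → removeHook (largestIn p) p) addHook
                       removeHook∘addHook (λ (_ , p) → addHook∘removeHook (largestIn p) p)

¬⇒↔Fin0 : ∀ {A : Set} → ¬ A → A ↔ Fin 0
¬⇒↔Fin0 ¬a = mk↔ₛ′ (⊥-elim ∘ ¬a) (λ ()) (λ ()) (⊥-elim ∘ ¬a)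

⊎↔Fin+ : ∀ {A B : Set} {a b} → A ↔ Fin a → B ↔ Fin b → (A ⊎ B) ↔ Fin (a + b)
⊎↔Fin+ A↔a B↔b = ↔-trans (A↔a ⊎-↔ B↔b) (↔-sym +↔⊎)

emptyTableau : IsHook 0 0 true [] [] []
emptyTableau = isHook [] [] [] ([] , [] , refl) refl [] tt refl

Hook-zero : ∀ {h b} (x : Hook 0 h b) → proj₁ x ≡ ([] , [] , []) × h ≡ 0 × b ≡ true
Hook-zero (([] , [] , []) , p)    = refl , sym (excess p) , sym (row₁-null p)
Hook-zero ((_ ∷ _ , _ , _) , p)   with () ← proj₂ (proj₂ (entries p))
Hook-zero (([] , _ ∷ _ , _) , p)  with () ← proj₂ (proj₂ (entries p))
Hook-zero (([] , [] , _ ∷ _) , p) with () ← proj₂ (proj₂ (entries p))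

Hook↔Fin : ∀ n h → (Hook n h true ↔ Fin (rowCount n h)) × (Hook n h false ↔ Fin (hookCount n h))
AfterRow₁OrCol↔Fin : ∀ n h → AfterRow₁OrCol n h ↔ Fin (rowCount n (suc h) + hookCount n (suc h) + hookCount n h)

AfterRow₁OrCol↔Fin n h = ⊎↔Fin+ (⊎↔Fin+ (proj₁ (Hook↔Fin n (suc h))) (proj₂ (Hook↔Fin n (suc h)))) (proj₂ (Hook↔Fin n h))

Hook↔Fin zero zero =
  mk↔ₛ′ (λ _ → Fin.zero) (λ _ → _ , emptyTableau)
        (λ { Fin.zero → refl ; (Fin.suc ()) }) (λ x → Hook-≡ (sym (proj₁ (Hook-zero x)))) ,
  ¬⇒↔Fin0 (λ x → contradiction (proj₂ (proj₂ (Hook-zero x))) λ ())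
Hook↔Fin zero (suc h) =
  ¬⇒↔Fin0 (λ x → contradiction (proj₁ (proj₂ (Hook-zero x))) λ ()) ,
  ¬⇒↔Fin0 (λ x → contradiction (proj₁ (proj₂ (Hook-zero x))) λ ())
Hook↔Fin (suc n) zero =
  ↔-trans oneRow↔AfterRow₀ (¬⇒↔Fin0 id) ,
  ↔-trans hook↔AfterRemoval (⊎↔Fin+ (¬⇒↔Fin0 id) (AfterRow₁OrCol↔Fin n 0))
Hook↔Fin (suc n) (suc h) =
  ↔-trans oneRow↔AfterRow₀ (proj₁ (Hook↔Fin n h)) ,
  ↔-trans hook↔AfterRemoval (⊎↔Fin+ (proj₂ (Hook↔Fin n h)) (AfterRow₁OrCol↔Fin n (suc h)))

-- Standard Young tableaux of shape (λ₁, λ₂, 1^m)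

hookRows : Triple → List (List ℕ)
hookRows (r₀ , r₁ , c) = r₀ ∷ r₁ ∷ map [_] c

IsSYT21 : ℕ → ℕ → List (List ℕ) → Set
IsSYT21 n k T = IsSYT n T × InHook21 k (shape T)

ColsIncreasing-irrelevant : ∀ T → Irrelevant (ColsIncreasing T)
ColsIncreasing-irrelevant []            tt tt = refl
ColsIncreasing-irrelevant (_ ∷ [])      tt tt = refl
ColsIncreasing-irrelevant (_ ∷ r′ ∷ rs) p  q  =
  ×-irrelevant (All.irrelevant <-irrelevant) (ColsIncreasing-irrelevant (r′ ∷ rs)) p q

IsSYT21-irrelevant : ∀ {n k} T → Irrelevant (IsSYT21 n k T)
IsSYT21-irrelevant T =
  ×-irrelevant
    (×-irrelevant (×-irrelevant (All.irrelevant ≤-irrelevant) (Linked.irrelevant ≤-irrelevant))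
    (×-irrelevant ≡-irrelevant
    (×-irrelevant (All.irrelevant (×-irrelevant ≤-irrelevant ≤-irrelevant))
    (×-irrelevant (All.irrelevant ≡-irrelevant)
    (×-irrelevant (All.irrelevant (Linked.irrelevant <-irrelevant)) (ColsIncreasing-irrelevant T))))))
    (×-irrelevant (All.irrelevant ≤-irrelevant) ≡-irrelevant)

HookSYT : ℕ → ℕ → Set
HookSYT n k = Σ Triple (IsSYT21 n k ∘ hookRows)

heads : List (List ℕ) → List ℕ
heads []             = []
heads ([] ∷ rs)      = heads rs
heads ((x ∷ _) ∷ rs) = x ∷ heads rs

map-[]-heads : ∀ rs → All (λ r → 1 ≤ length r) rs → All (λ r → length r ≤ 1) rs → map [_] (heads rs) ≡ rs
map-[]-heads []                  _        _        = refl
map-[]-heads ((x ∷ []) ∷ rs)     (_ ∷ ps) (_ ∷ qs) = cong ([ x ] ∷_) (map-[]-heads rs ps qs)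
map-[]-heads ((_ ∷ _ ∷ _) ∷ _)   _        (s≤s () ∷ _)

heads-map-[] : ∀ c → heads (map [_] c) ≡ c
heads-map-[] []      = refl
heads-map-[] (x ∷ c) = cong (x ∷_) (heads-map-[] c)

k+2≰ : ∀ {k m} → m ≤ k → ¬ (k + 2 ≤ m)
k+2≰ {k} m≤k k+2≤m = <-irrefl refl (<-≤-trans (m<m+n k z<s) (≤-trans k+2≤m m≤k))

module _ {n k : ℕ} (k+2≤n : k + 2 ≤ n) where

  ¬IsSYT21-[] : ¬ IsSYT21 n k []
  ¬IsSYT21-[] ((_ , sum≡n , _) , _) = k+2≰ {k} (subst (_≤ k) sum≡n z≤n) k+2≤n

  ¬IsSYT21-[r₀] : ∀ r₀ → ¬ IsSYT21 n k [ r₀ ]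
  ¬IsSYT21-[r₀] _ ((_ , sum≡n , _) , (_ , r₀≡k)) =
    k+2≰ {k} (≤-reflexive (trans (sym sum≡n) (trans (+-identityʳ _) r₀≡k))) k+2≤n

  toHookSYT : SYT21 n k → HookSYT n k
  toHookSYT ([] , p)         = ⊥-elim (¬IsSYT21-[] p)
  toHookSYT ((r₀ ∷ []) , p)  = ⊥-elim (¬IsSYT21-[r₀] r₀ p)
  toHookSYT ((r₀ ∷ r₁ ∷ rs) , p@(((_ ∷ _ ∷ rs≥1) , _) , _) , (rs≤1 , r₀≡r₁+k)) =
    (r₀ , r₁ , heads rs) , subst (IsSYT21 n k) (cong (λ rs′ → r₀ ∷ r₁ ∷ rs′) (sym rs≡)) (p , rs≤1 , r₀≡r₁+k)
    where rs≡ : map [_] (heads rs) ≡ rs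
          rs≡ = map-[]-heads rs (All.map⁻ rs≥1) (All.map⁻ rs≤1)

  SYT21↔HookSYT : SYT21 n k ↔ HookSYT n k
  SYT21↔HookSYT = mk↔ₛ′ toHookSYT (λ (t , p) → hookRows t , p) to∘from from∘to
    where
    to∘from : ∀ y → toHookSYT (hookRows (proj₁ y) , proj₂ y) ≡ y
    to∘from ((r₀ , r₁ , c) , (((_ ∷ _ ∷ _) , _) , _) , _) =
      Σ-≡ (IsSYT21-irrelevant ∘ hookRows) (cong (λ c′ → r₀ , r₁ , c′) (heads-map-[] c))
    from∘to : ∀ x → (hookRows (proj₁ (toHookSYT x)) , proj₂ (toHookSYT x)) ≡ x
    from∘to ([] , p)        = ⊥-elim (¬IsSYT21-[] p)
    from∘to ((r₀ ∷ []) , p) = ⊥-elim (¬IsSYT21-[r₀] r₀ p)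
    from∘to ((r₀ ∷ r₁ ∷ rs) , (((_ ∷ _ ∷ rs≥1) , _) , _) , (rs≤1 , _)) =
      Σ-≡ IsSYT21-irrelevant (cong (λ rs′ → r₀ ∷ r₁ ∷ rs′) (map-[]-heads rs (All.map⁻ rs≥1) (All.map⁻ rs≤1)))

Linked-reverse : ∀ {R : ℕ → ℕ → Set} xs → Linked R xs → Linked (flip R) (reverse xs)
Linked-reverse []       _ = []
Linked-reverse (x ∷ xs) l = go x xs [] l [-]
  where
  go : ∀ {R : ℕ → ℕ → Set} x xs acc → Linked R (x ∷ xs) → Linked (flip R) (x ∷ acc) → Linked (flip R) (reverseAcc (x ∷ acc) xs)
  go x []       acc _         a = a
  go x (y ∷ xs) acc (r ∷ l)   a = go y xs (x ∷ acc) l (r ∷ a)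

reverse-∷ : ∀ x xs → Σ (List ℕ) λ rest → reverse (x ∷ xs) ≡ last⁺ x xs ∷ rest
reverse-∷ x xs = go x xs []
  where
  go : ∀ x xs acc → Σ (List ℕ) λ rest → reverseAcc (x ∷ acc) xs ≡ last⁺ x xs ∷ rest
  go x []       acc = acc , refl
  go x (y ∷ xs) acc = go y xs (x ∷ acc)

zip-++ˡ : ∀ (xs ys zs : List ℕ) → length xs ≡ length zs → zip (xs ++ ys) zs ≡ zip xs zs
zip-++ˡ []       ys []       _   = List.zipWith-zeroʳ _,_ ys
zip-++ˡ (x ∷ xs) ys (z ∷ zs) len = cong ((x , z) ∷_) (zip-++ˡ xs ys zs (suc-injective len))

zip-∷ʳ : ∀ (xs ys : List ℕ) x y → length xs ≡ length ys → zip (xs ∷ʳ x) (ys ∷ʳ y) ≡ zip xs ys ∷ʳ (x , y)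
zip-∷ʳ []        []       _ _ _   = refl
zip-∷ʳ (x′ ∷ xs) (y′ ∷ ys) x y len = cong ((x′ , y′) ∷_) (zip-∷ʳ xs ys x y (suc-injective len))

zip-reverse : ∀ (xs ys : List ℕ) → length xs ≡ length ys → zip (reverse xs) (reverse ys) ≡ reverse (zip xs ys)
zip-reverse []       []       _   = refl
zip-reverse (x ∷ xs) (y ∷ ys) len = begin
  zip (reverse (x ∷ xs)) (reverse (y ∷ ys)) ≡⟨ cong₂ zip (List.unfold-reverse x xs) (List.unfold-reverse y ys) ⟩
  zip (reverse xs ∷ʳ x) (reverse ys ∷ʳ y)   ≡⟨ zip-∷ʳ (reverse xs) (reverse ys) x y
                                                  (trans (List.length-reverse xs) (trans (suc-injective len) (sym (List.length-reverse ys)))) ⟩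
  zip (reverse xs) (reverse ys) ∷ʳ (x , y)   ≡⟨ cong (_∷ʳ (x , y)) (zip-reverse xs ys (suc-injective len)) ⟩
  reverse (zip xs ys) ∷ʳ (x , y)             ≡⟨ List.unfold-reverse (x , y) (zip xs ys) ⟨
  reverse (zip (x ∷ xs) (y ∷ ys))            ∎
  where open ≡-Reasoning

-- Read backwards, rows of lengths m + k and m are aligned at their ends; dropping k entries of
-- the longer reversed row aligns them at their heads.
zip-reverse-drop : ∀ (xs ys : List ℕ) k → length xs ≡ length ys + k →
  zip (reverse xs) (reverse ys) ≡ reverse (map swap (zip ys (drop k xs)))
zip-reverse-drop xs ys k len = begin
  zip (reverse xs) (reverse ys)
    ≡⟨ cong (λ zs → zip zs (reverse ys)) (trans (cong reverse (sym (List.take++drop≡id k xs))) (List.reverse-++ (take k xs) (drop k xs))) ⟩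
  zip (reverse (drop k xs) ++ reverse (take k xs)) (reverse ys)
    ≡⟨ zip-++ˡ (reverse (drop k xs)) _ (reverse ys) (trans (List.length-reverse (drop k xs)) (trans len-drop (sym (List.length-reverse ys)))) ⟩
  zip (reverse (drop k xs)) (reverse ys)
    ≡⟨ zip-reverse (drop k xs) ys len-drop ⟩
  reverse (zip (drop k xs) ys)
    ≡⟨ cong reverse (List.zip-flip (drop k xs) ys) ⟩
  reverse (map swap (zip ys (drop k xs))) ∎
  where
  open ≡-Reasoning
  len-drop : length (drop k xs) ≡ length ys
  len-drop = trans (List.length-drop k xs) (trans (cong (_∸ k) len) (m+n∸n≡m (length ys) k))

reverse³ : Triple → Triple
reverse³ (r₀ , r₁ , c) = reverse r₀ , reverse r₁ , reverse c

reverse³-involutive : ∀ t → reverse³ (reverse³ t) ≡ t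
reverse³-involutive (r₀ , r₁ , c) =
  cong₂ _,_ (List.reverse-involutive r₀) (cong₂ _,_ (List.reverse-involutive r₁) (List.reverse-involutive c))

HeadBelow : List ℕ → List ℕ → Set
HeadBelow r₁ []      = ⊤
HeadBelow r₁ (x ∷ _) = All (uncurry _<_) (zip r₁ [ x ])

ColsIncreasing-column : ∀ x c → ColsIncreasing ([ x ] ∷ map [_] c) → Linked _<_ (x ∷ c)
ColsIncreasing-column x []      _                 = [-]
ColsIncreasing-column x (y ∷ c) ((x<y ∷ []) , cs) = x<y ∷ ColsIncreasing-column y c cs

ColsIncreasing-column⁻ : ∀ x c → Linked _<_ (x ∷ c) → ColsIncreasing ([ x ] ∷ map [_] c)
ColsIncreasing-column⁻ x []      _         = tt
ColsIncreasing-column⁻ x (y ∷ c) (x<y ∷ l) = (x<y ∷ []) , ColsIncreasing-column⁻ y c l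

ColsIncreasing-hook : ∀ r₁ c → ColsIncreasing (r₁ ∷ map [_] c) → HeadBelow r₁ c × Linked _<_ c
ColsIncreasing-hook r₁ []      _          = tt , []
ColsIncreasing-hook r₁ (x ∷ c) (r₁<x , cs) = r₁<x , ColsIncreasing-column x c cs

ColsIncreasing-hook⁻ : ∀ r₁ c → HeadBelow r₁ c → Linked _<_ c → ColsIncreasing (r₁ ∷ map [_] c)
ColsIncreasing-hook⁻ r₁ []      _    _ = tt
ColsIncreasing-hook⁻ r₁ (x ∷ c) r₁<x l = r₁<x , ColsIncreasing-column⁻ x c l

HeadBelow-reverse : ∀ R₁ V → null R₁ ≡ false → FirstColumn R₁ V → HeadBelow (reverse R₁) (reverse V)
HeadBelow-reverse (y ∷ R₁) []      _ _   = tt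
HeadBelow-reverse (y ∷ R₁) (x ∷ V) _ y<x =
  subst₂ HeadBelow (sym (proj₂ (reverse-∷ y R₁))) (sym (proj₂ (reverse-∷ x V)))
    (y<x ∷ subst (All (uncurry _<_)) (sym (List.zipWith-zeroʳ _,_ (proj₁ (reverse-∷ y R₁)))) [])

HeadBelow-reverse⁻ : ∀ R₁ V → null R₁ ≡ false → HeadBelow (reverse R₁) (reverse V) → FirstColumn R₁ V
HeadBelow-reverse⁻ (y ∷ R₁) []      _ _ = tt
HeadBelow-reverse⁻ (y ∷ R₁) (x ∷ V) _ r₁<x
  with subst₂ HeadBelow (proj₂ (reverse-∷ y R₁)) (proj₂ (reverse-∷ x V)) r₁<x
... | y<x ∷ _ = y<x

ones : List ℕ → List ℕ
ones c = map length (map [_] c)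

ones-≥1 : ∀ c → All (1 ≤_) (ones c)
ones-≥1 c = All.map⁺ (All.map⁺ (All.universal (λ _ → s≤s z≤n) c))

ones-≤1 : ∀ c → All (_≤ 1) (ones c)
ones-≤1 c = All.map⁺ (All.map⁺ (All.universal (λ _ → s≤s z≤n) c))

sum-ones : ∀ c → sum (ones c) ≡ length c
sum-ones []      = refl
sum-ones (_ ∷ c) = cong suc (sum-ones c)

Linked-≥-ones : ∀ {m} c → 1 ≤ m → Linked _≥_ (m ∷ ones c)
Linked-≥-ones []      _   = [-]
Linked-≥-ones (_ ∷ c) 1≤m = 1≤m ∷ Linked-≥-ones c ≤-refl

concat-hookRows : ∀ r₀ r₁ c → concat (hookRows (r₀ , r₁ , c)) ≡ r₀ ++ r₁ ++ c
concat-hookRows r₀ r₁ c = cong (λ c′ → r₀ ++ r₁ ++ c′) (List.concat-map-[ c ])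

reverse-rows-↭ : ∀ (r₀ r₁ c : List ℕ) → reverse r₀ ++ reverse r₁ ++ reverse c ↭ r₀ ++ r₁ ++ c
reverse-rows-↭ r₀ r₁ c = ++⁺ (↭-reverse r₀) (++⁺ (↭-reverse r₁) (↭-reverse c))

length-hookRows : ∀ r₀ r₁ c → length (concat (hookRows (r₀ , r₁ , c))) ≡ sum (shape (hookRows (r₀ , r₁ , c)))
length-hookRows r₀ r₁ c = begin
  length (concat (hookRows (r₀ , r₁ , c)))      ≡⟨ cong length (concat-hookRows r₀ r₁ c) ⟩
  length (r₀ ++ r₁ ++ c)                       ≡⟨ List.length-++ r₀ ⟩
  length r₀ + length (r₁ ++ c)                 ≡⟨ cong (_+_ (length r₀)) (List.length-++ r₁) ⟩
  length r₀ + (length r₁ + length c)           ≡⟨ cong (λ x → length r₀ + (length r₁ + x)) (sum-ones c) ⟨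
  length r₀ + (length r₁ + sum (ones c))       ∎
  where open ≡-Reasoning

null-reverse : ∀ xs → null (reverse xs) ≡ null xs
null-reverse []       = refl
null-reverse (x ∷ xs) = cong null (proj₂ (reverse-∷ x xs))

1≤length⇒null≡false : ∀ {xs : List ℕ} → 1 ≤ length xs → null xs ≡ false
1≤length⇒null≡false {_ ∷ _} _ = refl

null≡false⇒1≤length : ∀ {xs : List ℕ} → null xs ≡ false → 1 ≤ length xs
null≡false⇒1≤length {_ ∷ _} _ = s≤s z≤n

All-reverse-swap⁺ : ∀ (Z : List (ℕ × ℕ)) → All (uncurry _>_) Z → All (uncurry _<_) (reverse (map swap Z))
All-reverse-swap⁺ Z a = All-resp-↭ (↭-sym (↭-reverse _)) (All.map⁺ a)

All-reverse-swap⁻ : ∀ (Z : List (ℕ × ℕ)) → All (uncurry _<_) (reverse (map swap Z)) → All (uncurry _>_) Z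
All-reverse-swap⁻ Z a = All.map⁻ (All-resp-↭ (↭-reverse _) a)

module _ {n k : ℕ} where

  toHook : HookSYT n k → Hook n k false
  toHook ((r₀ , r₁ , c) , (((_ ∷ 1≤len₁ ∷ _) , _) , sum≡n , inRange , once , (inc₀ ∷ inc₁ ∷ _) , (cols₀₁ , cols₁c)) , (_ , len≡)) =
    reverse³ (r₀ , r₁ , c) , record
      { row₀-desc = Linked-reverse r₀ inc₀
      ; row₁-desc = Linked-reverse r₁ inc₁
      ; col-desc  = Linked-reverse c (proj₂ (ColsIncreasing-hook r₁ c cols₁c))
      ; entries   = All-resp-↭ (↭-sym perm) inRange , All.map (λ e → trans (occ-↭ perm) e) once ,
                    trans (↭-length perm) (trans (length-hookRows r₀ r₁ c) sum≡n)
      ; excess    = excess′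
      ; columns   = All-reverse-swap⁻ _ (subst (All (uncurry _<_)) zip≡ cols₀₁)
      ; corner    = HeadBelow-reverse⁻ (reverse r₁) (reverse c) null≡false
                      (subst₂ HeadBelow (sym (List.reverse-involutive r₁)) (sym (List.reverse-involutive c))
                        (proj₁ (ColsIncreasing-hook r₁ c cols₁c)))
      ; row₁-null = null≡false
      }
    where
    perm : reverse r₀ ++ reverse r₁ ++ reverse c ↭ concat (hookRows (r₀ , r₁ , c))
    perm = subst (reverse r₀ ++ reverse r₁ ++ reverse c ↭_) (sym (concat-hookRows r₀ r₁ c)) (reverse-rows-↭ r₀ r₁ c)
    excess′ : length (reverse r₀) ≡ length (reverse r₁) + k
    excess′ = trans (List.length-reverse r₀) (trans len≡ (cong (_+ k) (sym (List.length-reverse r₁))))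
    zip≡ : zip r₀ r₁ ≡ reverse (map swap (zip (reverse r₁) (drop k (reverse r₀))))
    zip≡ = trans (cong₂ zip (sym (List.reverse-involutive r₀)) (sym (List.reverse-involutive r₁)))
                 (zip-reverse-drop (reverse r₀) (reverse r₁) k excess′)
    null≡false : null (reverse r₁) ≡ false
    null≡false = trans (null-reverse r₁) (1≤length⇒null≡false 1≤len₁)

  fromHook : Hook n k false → HookSYT n k
  fromHook ((R₀ , R₁ , V) , p) =
    reverse³ (R₀ , R₁ , V) ,
    ( ((≤-trans 1≤len₁ len₁≤len₀ ∷ 1≤len₁ ∷ ones-≥1 (reverse V)) , (len₁≤len₀ ∷ Linked-≥-ones (reverse V) 1≤len₁))
    , trans (sym (length-hookRows (reverse R₀) (reverse R₁) (reverse V))) (trans (↭-length perm) (proj₂ (proj₂ (entries p))))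
    , All-resp-↭ (↭-sym perm) (proj₁ (entries p))
    , All.map (λ e → trans (occ-↭ perm) e) (proj₁ (proj₂ (entries p)))
    , (Linked-reverse R₀ (row₀-desc p) ∷ Linked-reverse R₁ (row₁-desc p) ∷ All.map⁺ (All.universal (λ _ → [-]) (reverse V)))
    , ( subst (All (uncurry _<_)) (sym (zip-reverse-drop R₀ R₁ k (excess p))) (All-reverse-swap⁺ _ (columns p))
      , ColsIncreasing-hook⁻ (reverse R₁) (reverse V) (HeadBelow-reverse R₁ V (row₁-null p) (corner p)) (Linked-reverse V (col-desc p))))
    , (ones-≤1 (reverse V) , len)
    where
    perm : concat (hookRows (reverse R₀ , reverse R₁ , reverse V)) ↭ R₀ ++ R₁ ++ V
    perm = subst (_↭ R₀ ++ R₁ ++ V) (sym (concat-hookRows (reverse R₀) (reverse R₁) (reverse V))) (reverse-rows-↭ R₀ R₁ V)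
    len : length (reverse R₀) ≡ length (reverse R₁) + k
    len = trans (List.length-reverse R₀) (trans (excess p) (cong (_+ k) (sym (List.length-reverse R₁))))
    1≤len₁ : 1 ≤ length (reverse R₁)
    1≤len₁ = null≡false⇒1≤length (trans (null-reverse R₁) (row₁-null p))
    len₁≤len₀ : length (reverse R₁) ≤ length (reverse R₀)
    len₁≤len₀ = subst (length (reverse R₁) ≤_) (sym len) (m≤m+n _ k)

  HookSYT↔Hook : HookSYT n k ↔ Hook n k false
  HookSYT↔Hook = mk↔ₛ′ toHook fromHook to∘from from∘to
    where
    to∘from : ∀ y → toHook (fromHook y) ≡ y
    to∘from (t , _) = Hook-≡ (reverse³-involutive t)
    from∘to : ∀ x → fromHook (toHook x) ≡ x
    from∘to ((r₀ , r₁ , c) , (((_ ∷ _ ∷ _) , _) , _ , _ , _ , (_ ∷ _ ∷ _) , _) , _) =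
      Σ-≡ (IsSYT21-irrelevant ∘ hookRows) (reverse³-involutive (r₀ , r₁ , c))

theorem1p2 : (n k : ℕ) → k + 2 ≤ n →
    Σ ℕ (λ N → (SYT21 n k ↔ Fin N) × ((+ N) / 1 ≡ rhs n k))
theorem1p2 n k k+2≤n =
  hookCount n k ,
  ↔-trans (SYT21↔HookSYT k+2≤n) (↔-trans HookSYT↔Hook (proj₂ (Hook↔Fin n k))) ,
  subst (λ n → fromℕ (hookCount n k) ≡ rhs n k) (m+[n∸m]≡n k<n) (hookCount≡rhs k (n ∸ suc k))
  where
  k<n : k < n
  k<n = ≤-trans (m≤m+n (suc k) 1) (subst (_≤ n) (+-suc k 1) k+2≤n)
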